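{- Let $G=(V,E)$ be a finite simple undirected graph with $W>0$, and let $k\ge 1$. Let $\widehat C_1,\dots,\widehat C_6$ be the outputs of the algorithm $\mathtt{3\text{ - }path\text{ - }sampler}$ run on $G$ with $k$ samples. Then for every $i\in\{1,\dots,6\}$, $\mathbf{E}[\widehat C_i]=C_i$.
   Context: For a vertex $v$, $d_v$ is its degree and $N(v)$ its neighbour set. The six connected 4-vertex graphs ("motifs") are indexed as: 1 = 3-star ($K_{1,3}$), 2 = 3-path (path on 4 vertices), 3 = tailed triangle (a triangle with one pendant edge attached), 4 = 4-cycle, 5 = chordal-4-cycle ($K_4$ minus one edge), 6 = 4-clique. $C_i$ is the number of 4-element vertex subsets $S\subseteq V$ whose induced subgraph $G[S]$ is isomorphic to motif $i$. A 3-path in $G$ is a set of three edges $\{(a,b),(b,c),(c,d)\}$ with $a,b,c,d$ distinct. Let $A_{2,i}$ be the number of 3-paths (as subgraphs) contained in motif $i$: $A_{2,2}=1$, $A_{2,3}=2$, $A_{2,4}=4$, $A_{2,5}=6$, $A_{2,6}=12$. For each edge $e=(u,v)$ let $\tau_e=(d_u-1)(d_v-1)$ and $W=\sum_{e\in E}\tau_e$. Procedure $\mathtt{sample}$: pick an edge $e=(u,v)$ with probability $\tau_e/W$; pick $u'$ uniformly from $N(u)\setminus\{v\}$ and independently $v'$ uniformly from $N(v)\setminus\{u\}$; output $\{(u',u),(u,v),(v,v')\}$. Algorithm $\mathtt{3\text{ - }path\text{ - }sampler}$ with $k$ samples: run $\mathtt{sample}$ $k$ times independently, and let $S_\ell$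 be the set of vertices of the $\ell$-th output; for $i\in\{2,\dots,6\}$ let $count_i$ be the number of $\ell$ such that $S_\ell$ has 4 vertices and $G[S_\ell]$ is isomorphic to motif $i$; set $\widehat C_i=(count_i/k)\cdot(W/A_{2,i})$ for $i\in\{2,\dots,6\}$; set $N_1=\sum_{v\in V}\binom{d_v}{3}$ and $\widehat C_1=N_1-\widehat C_3-2\widehat C_5-4\widehat C_6$. -}

module Defs where

open import Data.Nat as ℕ using (ℕ; zero; suc; _∸_; _<ᵇ_)
open import Data.Integer as ℤ using (+_)
open import Data.Rational as ℚ using (ℚ; 0ℚ; _/_)
open import Data.Bool using (Bool; true; false; _∧_; _∨_; not; if_then_else_)
import Data.Bool.Properties as BoolP
open import Data.Fin as Fin using (Fin; toℕ)
open import Data.List using (List; []; _∷_; foldr; map; allFin)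
open import Data.Vec using (Vec; []; _∷_; lookup)
open import Data.Product using (_×_; _,_)
open import Relation.Nullary.Decidable using (⌊_⌋)
open import Relation.Binary.PropositionalEquality using (_≡_)

record Graph (n : ℕ) : Set where
  field
    adj    : Fin n → Fin n → Bool
    sym    : ∀ x y → adj x y ≡ adj y x
    irrefl : ∀ x → adj x x ≡ false
open Graph public

countFin : ∀ {n} → (Fin n → Bool) → ℕ
countFin {n} p = foldr (λ x acc → if p x then suc acc else acc) 0 (allFin n)

sumFin : ∀ {n} → (Fin n → ℚ) → ℚ
sumFin {n} f = foldr (λ x acc → f x ℚ.+ acc) 0ℚ (allFin n)

anyFin : ∀ {n} → (Fin n → Bool) → Bool
anyFin {n} p = foldr (λ x acc → p x ∨ acc) false (allFin n)

allFinB : ∀ {n} → (Fin n → Bool) → Bool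
allFinB {n} p = foldr (λ x acc → p x ∧ acc) true (allFin n)

-- a / b as a rational; 0 when b = 0 (only used where b > 0 matters)
frac : ℕ → ℕ → ℚ
frac a zero    = 0ℚ
frac a (suc b) = (+ a) / suc b

sumFinℕ : ∀ {n} → (Fin n → ℕ) → ℕ
sumFinℕ {n} f = foldr (λ x acc → f x ℕ.+ acc) 0 (allFin n)

ℕtoℚ : ℕ → ℚ
ℕtoℚ a = (+ a) / 1

eqFin : ∀ {n} → Fin n → Fin n → Bool
eqFin x y = ⌊ x Fin.≟ y ⌋

eqBool : Bool → Bool → Bool
eqBool x y = ⌊ x BoolP.≟ y ⌋

module _ {n : ℕ} (G : Graph n) where

  deg : Fin n → ℕ
  deg v = countFin (adj G v)

  -- edges are enumerated as ordered pairs (u , v) with u < v and u ~ v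
  isEdge : Fin n → Fin n → Bool
  isEdge u v = (toℕ u <ᵇ toℕ v) ∧ adj G u v

  τ : Fin n → Fin n → ℕ
  τ u v = (deg u ∸ 1) ℕ.* (deg v ∸ 1)

  W : ℕ
  W = foldr ℕ._+_ 0 (map (λ u → foldr ℕ._+_ 0
        (map (λ v → if isEdge u v then τ u v else 0) (allFin n))) (allFin n))

  choose3 : ℕ → ℕ
  choose3 d = d ℕ.* (d ∸ 1) ℕ.* (d ∸ 2) ℕ./ 6

  N₁ : ℕ
  N₁ = foldr ℕ._+_ 0 (map (λ v → choose3 (deg v)) (allFin n))

data Motif : Set where
  star3 path3 tailedTriangle cycle4 chordalCycle4 clique4 : Motif

f0 f1 f2 f3 : Fin 4
f0 = Fin.zero
f1 = Fin.suc Fin.zero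
f2 = Fin.suc (Fin.suc Fin.zero)
f3 = Fin.suc (Fin.suc (Fin.suc Fin.zero))

motifEdges : Motif → List (Fin 4 × Fin 4)
motifEdges star3          = (f0 , f1) ∷ (f0 , f2) ∷ (f0 , f3) ∷ []
motifEdges path3          = (f0 , f1) ∷ (f1 , f2) ∷ (f2 , f3) ∷ []
motifEdges tailedTriangle = (f0 , f1) ∷ (f1 , f2) ∷ (f0 , f2) ∷ (f2 , f3) ∷ []
motifEdges cycle4         = (f0 , f1) ∷ (f1 , f2) ∷ (f2 , f3) ∷ (f3 , f0) ∷ []
motifEdges chordalCycle4  = (f0 , f1) ∷ (f1 , f2) ∷ (f2 , f3) ∷ (f3 , f0) ∷ (f0 , f2) ∷ []
motifEdges clique4        = (f0 , f1) ∷ (f0 , f2) ∷ (f0 , f3) ∷ (f1 , f2) ∷ (f1 , f3) ∷ (f2 , f3) ∷ []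

motifAdj : Motif → Fin 4 → Fin 4 → Bool
motifAdj m a b = foldr (λ { (x , y) acc →
  (eqFin a x ∧ eqFin b y) ∨ (eqFin a y ∧ eqFin b x) ∨ acc }) false (motifEdges m)

-- A_{2,i}: number of 3-paths contained in motif i (A_{2,1} = 0 is unused)
A₂ : Motif → ℕ
A₂ star3          = 0
A₂ path3          = 1
A₂ tailedTriangle = 2
A₂ cycle4         = 4
A₂ chordalCycle4  = 6
A₂ clique4        = 12

distinct4 : ∀ {n} → Fin n → Fin n → Fin n → Fin n → Bool
distinct4 a b c d = not (eqFin a b) ∧ not (eqFin a c) ∧ not (eqFin a d)
                  ∧ not (eqFin b c) ∧ not (eqFin b d) ∧ not (eqFin c d)

module _ {n : ℕ} (G : Graph n) where

  -- G[{s₀,s₁,s₂,s₃}] ≅ motif m  (s pairwise distinct): there is a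
  -- bijection σ : Fin 4 → Fin 4 with  s (σ x) ~ s (σ y)  ⇔  x ~_m y.
  inducedIso : Vec (Fin n) 4 → Motif → Bool
  inducedIso s m =
    anyFin λ a → anyFin λ b → anyFin λ c → anyFin λ d →
      distinct4 a b c d ∧
      allFinB λ x → allFinB λ y →
        eqBool (adj G (lookup s (lookup (a ∷ b ∷ c ∷ d ∷ []) x))
                      (lookup s (lookup (a ∷ b ∷ c ∷ d ∷ []) y)))
               (motifAdj m x y)

  -- C_i: number of 4-subsets S (enumerated as a < b < c < d) with G[S] ≅ motif i
  C : Motif → ℕ
  C m = sumFinℕ λ a → sumFinℕ λ b → sumFinℕ λ c → countFin λ d →
          (toℕ a <ᵇ toℕ b) ∧ (toℕ b <ᵇ toℕ c) ∧ (toℕ c <ᵇ toℕ d) ∧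
          inducedIso (a ∷ b ∷ c ∷ d ∷ []) m

  -- An output {(u',u),(u,v),(v,v')} is recorded as the vertex list [u', u, v, v'].
  Outcome : Set
  Outcome = Vec (Fin n) 4

  -- Expectation of f over one run of `sample`:
  -- edge e = (u,v) with prob. τ_e / W, then u' uniform in N(u)∖{v},
  -- v' uniform in N(v)∖{u}, independently.
  E₁ : (Outcome → ℚ) → ℚ
  E₁ f = sumFin λ u → sumFin λ v →
    if isEdge G u v
    then frac (τ G u v) (W G) ℚ.*
      (sumFin λ u' →
        if adj G u u' ∧ not (eqFin u' v)
        then frac 1 (deg G u ∸ 1) ℚ.*
          (sumFin λ v' →
            if adj G v v' ∧ not (eqFin v' u)
            then frac 1 (deg G v ∸ 1) ℚ.* f (u' ∷ u ∷ v ∷ v' ∷ [])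
            else 0ℚ)
        else 0ℚ)
    else 0ℚ

  Eₖ : (k : ℕ) → (Vec Outcome k → ℚ) → ℚ
  Eₖ zero    g = g []
  Eₖ (suc k) g = E₁ λ x → Eₖ k λ xs → g (x ∷ xs)

  isMotif : Motif → Outcome → Bool
  isMotif m s = distinct4 (lookup s f0) (lookup s f1) (lookup s f2) (lookup s f3)
                ∧ inducedIso s m

  count : ∀ {k} → Motif → Vec Outcome k → ℕ
  count m []       = 0
  count m (s ∷ xs) = if isMotif m s then suc (count m xs) else count m xs

  Ĉ' : ∀ {k} → Motif → Vec Outcome k → ℚ
  Ĉ' {k} m xs = frac (count m xs) k ℚ.* frac (W G) (A₂ m)

  Ĉ : ∀ {k} → Motif → Vec Outcome k → ℚ
  Ĉ star3 xs = ℕtoℚ (N₁ G) ℚ.- Ĉ' tailedTriangle xs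
                ℚ.- ℕtoℚ 2 ℚ.* Ĉ' chordalCycle4 xs ℚ.- ℕtoℚ 4 ℚ.* Ĉ' clique4 xs
  Ĉ path3          xs = Ĉ' path3 xs
  Ĉ tailedTriangle xs = Ĉ' tailedTriangle xs
  Ĉ cycle4         xs = Ĉ' cycle4 xs
  Ĉ chordalCycle4  xs = Ĉ' chordalCycle4 xs
  Ĉ clique4        xs = Ĉ' clique4 xs

module Submission where

open import Defs renaming (sym to adj-sym; irrefl to adj-irrefl)
open import Data.Nat using (ℕ; _<_; _≥_; s≤s; z≤n)
open import Data.Rational using (ℚ)
open import Relation.Binary.PropositionalEquality using (_≡_)

-- A run of `sample` is recorded by a tuple t = (u , v , u' , v') where (u , v)
-- is an enumerated edge (u < v), u' ∈ N(u)∖{v} and v' ∈ N(v)∖{u}; call such a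
-- tuple a walk.  Its probability is τ_e/W · 1/(d_u-1) · 1/(d_v-1) = 1/W, so
-- E₁ f is 1/W times the sum of f over all walks, and there are exactly W walks.
-- Hence E₁, and by induction Eₖ, is linear and fixes constants,
-- E[count_i] = k·p_i with p_i = T_i/W, where T_i is the number of walks whose
-- vertex set induces motif i, and E[Ĉ_i] = T_i/A_{2,i} for i ∈ {2,…,6}.
--
-- The combinatorial core is  T_i = A_{2,i}·C_i  and  N₁ = C₁ + C₃ + 2C₅ + 4C₆.
-- Both follow by symmetrisation: summing a property that forces distinct
-- entries over all 4-tuples is summing, over the increasing tuples y, the
-- number of the 24 orderings of y with the property.  For increasing y that
-- number depends only on the graph induced on y, pulled back to Fin 4, and it
-- is evaluated on all 64 graphs on Fin 4: it is A_{2,i}·[G[y] ≅ motif i] for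
-- walks, and 6·([star] + [tailed triangle] + 2[chordal 4-cycle] + 4[clique])
-- for ordered 3-stars, which in total number 6·N₁.  The case Ĉ₁ then follows
-- from linearity.

module RationalArithmetic where

  open import Data.Nat as ℕ using (ℕ; zero; suc)
  import Data.Nat.Properties as ℕP
  open import Data.Integer as ℤ using (+_)
  import Data.Integer.Properties as ℤP
  open import Data.Rational as ℚ using (ℚ; 1ℚ; toℚᵘ; fromℚᵘ)
  import Data.Rational.Properties as ℚP
  open import Data.Rational.Unnormalised as ℚᵘ using (ℚᵘ; mkℚᵘ; *≡*)
  import Data.Rational.Unnormalised.Properties as ℚᵘP
  open import Relation.Binary.PropositionalEquality
  open import Data.Rational.Solver using (module +-*-Solver)
  open +-*-Solver

  -- Normalisation ℚᵘ → ℚ preserves sums and products; together with the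
  -- fact that  a ↦ a/1  is a homomorphism ℕ → ℚᵘ this gives the
  -- arithmetic of ℕtoℚ and of frac.
  fromℚᵘ-+ : ∀ p q → fromℚᵘ (p ℚᵘ.+ q) ≡ fromℚᵘ p ℚ.+ fromℚᵘ q
  fromℚᵘ-+ p q = ℚP.toℚᵘ-injective (ℚᵘP.≃-sym (ℚᵘP.≃-trans
    (ℚP.toℚᵘ-homo-+ (fromℚᵘ p) (fromℚᵘ q))
    (ℚᵘP.≃-trans (ℚᵘP.+-cong (ℚP.toℚᵘ-fromℚᵘ p) (ℚP.toℚᵘ-fromℚᵘ q))
                 (ℚᵘP.≃-sym (ℚP.toℚᵘ-fromℚᵘ (p ℚᵘ.+ q))))))

  fromℚᵘ-* : ∀ p q → fromℚᵘ (p ℚᵘ.* q) ≡ fromℚᵘ p ℚ.* fromℚᵘ q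
  fromℚᵘ-* p q = ℚP.toℚᵘ-injective (ℚᵘP.≃-sym (ℚᵘP.≃-trans
    (ℚP.toℚᵘ-homo-* (fromℚᵘ p) (fromℚᵘ q))
    (ℚᵘP.≃-trans (ℚᵘP.*-cong (ℚP.toℚᵘ-fromℚᵘ p) (ℚP.toℚᵘ-fromℚᵘ q))
                 (ℚᵘP.≃-sym (ℚP.toℚᵘ-fromℚᵘ (p ℚᵘ.* q))))))

  -- frac a (suc b) is, by definition, the normalisation of  a / (b + 1).
  fracᵘ : ℕ → ℕ → ℚᵘ
  fracᵘ a b = mkℚᵘ (+ a) b

  ℕtoℚ-+ : ∀ a b → ℕtoℚ (a ℕ.+ b) ≡ ℕtoℚ a ℚ.+ ℕtoℚ b
  ℕtoℚ-+ a b = trans (ℚP.fromℚᵘ-cong {fracᵘ (a ℕ.+ b) 0} {fracᵘ a 0 ℚᵘ.+ fracᵘ b 0} (*≡* numerators))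
                     (fromℚᵘ-+ (fracᵘ a 0) (fracᵘ b 0))
    where
    numerators : + (a ℕ.+ b) ℤ.* + 1 ≡ (+ a ℤ.* + 1 ℤ.+ + b ℤ.* + 1) ℤ.* + 1
    numerators = begin
      + (a ℕ.+ b) ℤ.* + 1            ≡⟨ ℤP.*-identityʳ _ ⟩
      + (a ℕ.+ b)                    ≡⟨ ℤP.pos-+ a b ⟩
      + a ℤ.+ + b                    ≡⟨ cong₂ ℤ._+_ (ℤP.*-identityʳ (+ a)) (ℤP.*-identityʳ (+ b)) ⟨
      + a ℤ.* + 1 ℤ.+ + b ℤ.* + 1    ≡⟨ ℤP.*-identityʳ _ ⟨
      (+ a ℤ.* + 1 ℤ.+ + b ℤ.* + 1) ℤ.* + 1 ∎
      where open ≡-Reasoning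

  ℕtoℚ-* : ∀ a b → ℕtoℚ (a ℕ.* b) ≡ ℕtoℚ a ℚ.* ℕtoℚ b
  ℕtoℚ-* a b = trans (ℚP.fromℚᵘ-cong {fracᵘ (a ℕ.* b) 0} {fracᵘ a 0 ℚᵘ.* fracᵘ b 0} (*≡* numerators))
                     (fromℚᵘ-* (fracᵘ a 0) (fracᵘ b 0))
    where
    numerators : + (a ℕ.* b) ℤ.* + 1 ≡ (+ a ℤ.* + b) ℤ.* + 1
    numerators = cong (ℤ._* + 1) (ℤP.pos-* a b)

  frac-split : ∀ a b → frac a b ≡ ℕtoℚ a ℚ.* frac 1 b
  frac-split a zero    = sym (ℚP.*-zeroʳ (ℕtoℚ a))
  frac-split a (suc b) = trans (ℚP.fromℚᵘ-cong {fracᵘ a b} {fracᵘ a 0 ℚᵘ.* fracᵘ 1 b} (*≡* numerators))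
                               (fromℚᵘ-* (fracᵘ a 0) (fracᵘ 1 b))
    where
    numerators : + a ℤ.* + (1 ℕ.* suc b) ≡ (+ a ℤ.* + 1) ℤ.* + suc b
    numerators = cong₂ ℤ._*_ (sym (ℤP.*-identityʳ (+ a))) (cong +_ (ℕP.*-identityˡ (suc b)))

  frac-inv : ∀ b → frac 1 (suc b) ℚ.* ℕtoℚ (suc b) ≡ 1ℚ
  frac-inv b = trans (sym (fromℚᵘ-* (fracᵘ 1 b) (fracᵘ (suc b) 0)))
                     (ℚP.fromℚᵘ-cong {fracᵘ 1 b ℚᵘ.* fracᵘ (suc b) 0} {fracᵘ 1 0} (*≡* numerators))
    where
    numerators : (+ 1 ℤ.* + suc b) ℤ.* + 1 ≡ + 1 ℤ.* + (suc b ℕ.* 1)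
    numerators = begin
      (+ 1 ℤ.* + suc b) ℤ.* + 1   ≡⟨ ℤP.*-identityʳ _ ⟩
      + 1 ℤ.* + suc b             ≡⟨ cong (λ d → + 1 ℤ.* + d) (ℕP.*-identityʳ (suc b)) ⟨
      + 1 ℤ.* + (suc b ℕ.* 1)     ∎
      where open ≡-Reasoning

  cancel-fracs : ∀ {w a} c → 0 ℕ.< w → 0 ℕ.< a → frac w a ℚ.* (frac 1 w ℚ.* ℕtoℚ (a ℕ.* c)) ≡ ℕtoℚ c
  cancel-fracs {suc w} {suc a} c _ _ = begin
    frac (suc w) (suc a) ℚ.* (frac 1 (suc w) ℚ.* ℕtoℚ (suc a ℕ.* c))
      ≡⟨ cong₂ (λ p q → p ℚ.* (frac 1 (suc w) ℚ.* q)) (frac-split (suc w) (suc a)) (ℕtoℚ-* (suc a) c) ⟩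
    (Wq ℚ.* ia) ℚ.* (iw ℚ.* (Aq ℚ.* Cq))
      ≡⟨ solve 5 (λ w′ ia iw a′ c′ → (w′ :* ia) :* (iw :* (a′ :* c′)) := (iw :* w′) :* ((ia :* a′) :* c′))
                 refl Wq ia iw Aq Cq ⟩
    (iw ℚ.* Wq) ℚ.* ((ia ℚ.* Aq) ℚ.* Cq)
      ≡⟨ cong₂ (λ p q → p ℚ.* (q ℚ.* Cq)) (frac-inv w) (frac-inv a) ⟩
    1ℚ ℚ.* (1ℚ ℚ.* Cq)
      ≡⟨ trans (ℚP.*-identityˡ (1ℚ ℚ.* Cq)) (ℚP.*-identityˡ Cq) ⟩
    Cq ∎
    where
    open ≡-Reasoning
    Wq Aq Cq ia iw : ℚ
    Wq = ℕtoℚ (suc w)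
    Aq = ℕtoℚ (suc a)
    Cq = ℕtoℚ c
    ia = frac 1 (suc a)
    iw = frac 1 (suc w)

open RationalArithmetic

module FiniteSums where

  open import Level using (Level)
  open import Algebra.Bundles using (Semiring; CommutativeRing)
  import Algebra.Properties.Semiring.Sum as SemiringSum
  open import Data.Nat using (ℕ; zero; suc; _+_; _*_)
  import Data.Nat.Properties as ℕP
  open import Data.Rational as ℚ using (ℚ; 0ℚ)
  import Data.Rational.Properties as ℚP
  import Data.Bool.Properties as BoolP
  open import Data.Bool using (Bool; true; false; _∧_; _∨_; not; if_then_else_)
  open import Data.Fin as Fin using (Fin)
  open import Data.List as List using (List; tabulate; allFin)
  import Data.List.Properties as ListP
  import Data.Vec.Functional as Vector
  open import Data.Product using (_×_; _,_)
  open import Function using (_∘_; id)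
  open import Relation.Nullary using (yes; no)
  open import Relation.Binary.PropositionalEquality hiding ([_])

  module ℕΣ = SemiringSum ℕP.+-*-semiring
  module ℚΣ = SemiringSum (CommutativeRing.semiring ℚP.+-*-commutativeRing)

  Σℕ : ∀ {n} → (Fin n → ℕ) → ℕ
  Σℕ = ℕΣ.sum

  Σℚ : ∀ {n} → (Fin n → ℚ) → ℚ
  Σℚ = ℚΣ.sum

  [_] : Bool → ℕ
  [ b ] = if b then 1 else 0

  [∧]≡[]*[] : ∀ a b → [ a ∧ b ] ≡ [ a ] * [ b ]
  [∧]≡[]*[] true  b = sym (ℕP.+-identityʳ [ b ])
  [∧]≡[]*[] false b = refl

  guard-[] : ∀ a b → (if a then [ b ] else 0) ≡ [ a ∧ b ]
  guard-[] true  b = refl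
  guard-[] false b = refl

  restrict-eq : ∀ b x y → (b ≡ true → x ≡ y) → [ b ] * x ≡ [ b ] * y
  restrict-eq true  x y eq = cong (_+ 0) (eq refl)
  restrict-eq false x y eq = refl

  foldr-tabulate : ∀ {A B : Set} {n} (_⊕_ : B → B → B) (e : B) (g : A → B) (f : Fin n → A) →
                   List.foldr (λ x acc → g x ⊕ acc) e (tabulate f) ≡ Vector.foldr _⊕_ e (g ∘ f)
  foldr-tabulate {n = zero}  _⊕_ e g f = refl
  foldr-tabulate {n = suc n} _⊕_ e g f = cong (g (f Fin.zero) ⊕_) (foldr-tabulate _⊕_ e g (f ∘ Fin.suc))

  sumFinℕ≡Σ : ∀ {n} (f : Fin n → ℕ) → sumFinℕ f ≡ Σℕ f
  sumFinℕ≡Σ f = foldr-tabulate _+_ 0 f id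

  sumFin≡Σ : ∀ {n} (f : Fin n → ℚ) → sumFin f ≡ Σℚ f
  sumFin≡Σ f = foldr-tabulate ℚ._+_ 0ℚ f id

  foldr-map≡Σ : ∀ {n} (f : Fin n → ℕ) → List.foldr _+_ 0 (List.map f (allFin n)) ≡ Σℕ f
  foldr-map≡Σ {n} f = trans (ListP.foldr-map _+_ f 0 (allFin n)) (foldr-tabulate _+_ 0 f id)

  countFin≡Σ : ∀ {n} (p : Fin n → Bool) → countFin p ≡ Σℕ (λ x → [ p x ])
  countFin≡Σ {n} p = trans (ListP.foldr-cong step refl (allFin n)) (foldr-tabulate _+_ 0 (λ x → [ p x ]) id)
    where
    step : ∀ x acc → (if p x then suc acc else acc) ≡ [ p x ] + acc
    step x acc with p x
    ... | true  = refl
    ... | false = refl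

  ℕtoℚ-Σ : ∀ {n} (f : Fin n → ℕ) → ℕtoℚ (Σℕ f) ≡ Σℚ (ℕtoℚ ∘ f)
  ℕtoℚ-Σ {zero}  f = refl
  ℕtoℚ-Σ {suc n} f = trans (ℕtoℚ-+ (f Fin.zero) _) (cong (ℕtoℚ (f Fin.zero) ℚ.+_) (ℕtoℚ-Σ (f ∘ Fin.suc)))

  eqFin-suc : ∀ {n} (x y : Fin n) → eqFin (Fin.suc x) (Fin.suc y) ≡ eqFin x y
  eqFin-suc x y with x Fin.≟ y
  ... | yes _ = refl
  ... | no  _ = refl

  count-single : ∀ {n} (r : Fin n → Bool) (u : Fin n) → Σℕ (λ x → [ r x ∧ eqFin x u ]) ≡ [ r u ]
  count-single {suc n} r Fin.zero = begin
    [ r Fin.zero ∧ true ] + Σℕ (λ x → [ r (Fin.suc x) ∧ false ])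
      ≡⟨ cong₂ _+_ (cong [_] (BoolP.∧-identityʳ (r Fin.zero)))
                   (ℕΣ.sum-cong-≗ {n} λ x → cong [_] (BoolP.∧-zeroʳ (r (Fin.suc x)))) ⟩
    [ r Fin.zero ] + Σℕ {n} (λ _ → 0)
      ≡⟨ cong ([ r Fin.zero ] +_) (ℕΣ.sum-replicate-zero n) ⟩
    [ r Fin.zero ] + 0
      ≡⟨ ℕP.+-identityʳ _ ⟩
    [ r Fin.zero ] ∎
    where open ≡-Reasoning
  count-single {suc n} r (Fin.suc u) = begin
    [ r Fin.zero ∧ false ] + Σℕ (λ x → [ r (Fin.suc x) ∧ eqFin (Fin.suc x) (Fin.suc u) ])
      ≡⟨ cong₂ _+_ (cong [_] (BoolP.∧-zeroʳ (r Fin.zero)))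
                   (ℕΣ.sum-cong-≗ (λ x → cong (λ b → [ r (Fin.suc x) ∧ b ]) (eqFin-suc x u))) ⟩
    0 + Σℕ (λ x → [ r (Fin.suc x) ∧ eqFin x u ])
      ≡⟨ count-single (r ∘ Fin.suc) u ⟩
    [ r (Fin.suc u) ] ∎
    where open ≡-Reasoning

  count-remove : ∀ {n} (r : Fin n → Bool) (u : Fin n) →
                 Σℕ (λ x → [ r x ]) ≡ Σℕ (λ x → [ r x ∧ not (eqFin x u) ]) + [ r u ]
  count-remove r u = begin
    Σℕ (λ x → [ r x ])
      ≡⟨ ℕΣ.sum-cong-≗ (λ x → split (r x) (eqFin x u)) ⟩
    Σℕ (λ x → [ r x ∧ not (eqFin x u) ] + [ r x ∧ eqFin x u ])
      ≡⟨ ℕΣ.∑-distrib-+ (λ x → [ r x ∧ not (eqFin x u) ]) (λ x → [ r x ∧ eqFin x u ]) ⟩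
    Σℕ (λ x → [ r x ∧ not (eqFin x u) ]) + Σℕ (λ x → [ r x ∧ eqFin x u ])
      ≡⟨ cong (Σℕ (λ x → [ r x ∧ not (eqFin x u) ]) +_) (count-single r u) ⟩
    Σℕ (λ x → [ r x ∧ not (eqFin x u) ]) + [ r u ] ∎
    where
    open ≡-Reasoning
    split : ∀ a b → [ a ] ≡ [ a ∧ not b ] + [ a ∧ b ]
    split true  true  = refl
    split true  false = refl
    split false b     = refl

  Tup : Set → Set
  Tup A = A × A × A × A

  module FourFoldSum {c ℓ : Level} (R : Semiring c ℓ) where
    open Semiring R using (Carrier; _≈_)
      renaming (_+_ to _+ᴿ_; _*_ to _*ᴿ_; trans to ≈-trans; sym to ≈-sym)
    open SemiringSum R using (sum; sum-cong-≋; ∑-distrib-+; *-distribˡ-sum)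

    Σ⁴ : ∀ {n} → (Tup (Fin n) → Carrier) → Carrier
    Σ⁴ F = sum λ a → sum λ b → sum λ c → sum λ d → F (a , b , c , d)

    Σ⁴-cong : ∀ {n} {F G : Tup (Fin n) → Carrier} → (∀ t → F t ≈ G t) → Σ⁴ F ≈ Σ⁴ G
    Σ⁴-cong e = sum-cong-≋ λ a → sum-cong-≋ λ b → sum-cong-≋ λ c → sum-cong-≋ λ d → e (a , b , c , d)

    Σ⁴-+ : ∀ {n} (F G : Tup (Fin n) → Carrier) → Σ⁴ (λ t → F t +ᴿ G t) ≈ Σ⁴ F +ᴿ Σ⁴ G
    Σ⁴-+ F G = ≈-trans (sum-cong-≋ λ a → ≈-trans (sum-cong-≋ λ b → ≈-trans (sum-cong-≋ λ c →
        ∑-distrib-+ (λ d → F (a , b , c , d)) (λ d → G (a , b , c , d)))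
        (∑-distrib-+ (λ c → sum λ d → F (a , b , c , d)) (λ c → sum λ d → G (a , b , c , d))))
        (∑-distrib-+ (λ b → sum λ c → sum λ d → F (a , b , c , d)) (λ b → sum λ c → sum λ d → G (a , b , c , d))))
        (∑-distrib-+ (λ a → sum λ b → sum λ c → sum λ d → F (a , b , c , d))
                     (λ a → sum λ b → sum λ c → sum λ d → G (a , b , c , d)))

    Σ⁴-*ˡ : ∀ {n} x (F : Tup (Fin n) → Carrier) → Σ⁴ (λ t → x *ᴿ F t) ≈ x *ᴿ Σ⁴ F
    Σ⁴-*ˡ x F = ≈-trans (sum-cong-≋ λ a → ≈-trans (sum-cong-≋ λ b → ≈-trans (sum-cong-≋ λ c →
        ≈-sym (*-distribˡ-sum x λ d → F (a , b , c , d)))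
        (≈-sym (*-distribˡ-sum x λ c → sum λ d → F (a , b , c , d))))
        (≈-sym (*-distribˡ-sum x λ b → sum λ c → sum λ d → F (a , b , c , d))))
        (≈-sym (*-distribˡ-sum x λ a → sum λ b → sum λ c → sum λ d → F (a , b , c , d)))

  module ℕΣ⁴ = FourFoldSum ℕP.+-*-semiring
  module ℚΣ⁴ = FourFoldSum (CommutativeRing.semiring ℚP.+-*-commutativeRing)

  ℕtoℚ-Σ⁴ : ∀ {n} (F : Tup (Fin n) → ℕ) → ℕtoℚ (ℕΣ⁴.Σ⁴ F) ≡ ℚΣ⁴.Σ⁴ (ℕtoℚ ∘ F)
  ℕtoℚ-Σ⁴ F =
    trans (ℕtoℚ-Σ λ a → Σℕ λ b → Σℕ λ c → Σℕ λ d → F (a , b , c , d)) (ℚΣ.sum-cong-≗ λ a →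
    trans (ℕtoℚ-Σ λ b → Σℕ λ c → Σℕ λ d → F (a , b , c , d))          (ℚΣ.sum-cong-≗ λ b →
    trans (ℕtoℚ-Σ λ c → Σℕ λ d → F (a , b , c , d))                   (ℚΣ.sum-cong-≗ λ c →
    ℕtoℚ-Σ λ d → F (a , b , c , d))))

  Σ-product : ∀ {m n} (f : Fin m → ℕ) (g : Fin n → ℕ) → Σℕ (λ i → Σℕ λ j → f i * g j) ≡ Σℕ f * Σℕ g
  Σ-product f g = begin
    Σℕ (λ i → Σℕ λ j → f i * g j)  ≡⟨ ℕΣ.sum-cong-≗ (λ i → ℕΣ.*-distribˡ-sum (f i) g) ⟨
    Σℕ (λ i → f i * Σℕ g)           ≡⟨ ℕΣ.*-distribʳ-sum (Σℕ g) f ⟨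
    Σℕ f * Σℕ g                     ∎
    where open ≡-Reasoning

  count-suc : ∀ {n} (r : Fin n → Bool) (u : Fin n) → r u ≡ true →
              Σℕ (λ x → [ r x ]) ≡ suc (Σℕ λ x → [ r x ∧ not (eqFin x u) ])
  count-suc r u ru = begin
    Σℕ (λ x → [ r x ])                     ≡⟨ count-remove r u ⟩
    rest + [ r u ]                         ≡⟨ cong (λ b → rest + [ b ]) ru ⟩
    rest + 1                               ≡⟨ ℕP.+-comm rest 1 ⟩
    suc rest                               ∎
    where
    open ≡-Reasoning
    rest : ℕ
    rest = Σℕ λ x → [ r x ∧ not (eqFin x u) ]

  allFinB-cong : ∀ {n} {p q : Fin n → Bool} → (∀ x → p x ≡ q x) → allFinB p ≡ allFinB q
  allFinB-cong {n} p≗q = ListP.foldr-cong (λ x acc → cong (_∧ acc) (p≗q x)) refl (allFin n)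

  anyFin-cong : ∀ {n} {p q : Fin n → Bool} → (∀ x → p x ≡ q x) → anyFin p ≡ anyFin q
  anyFin-cong {n} p≗q = ListP.foldr-cong (λ x acc → cong (_∨ acc) (p≗q x)) refl (allFin n)

  allFinB-intro : ∀ {n} (p : Fin n → Bool) → (∀ x → p x ≡ true) → allFinB p ≡ true
  allFinB-intro {n} p all = trans (foldr-tabulate _∧_ true p id) (go p all)
    where
    go : ∀ {m} (q : Fin m → Bool) → (∀ x → q x ≡ true) → Vector.foldr _∧_ true q ≡ true
    go {zero}  q all = refl
    go {suc m} q all rewrite all Fin.zero = go (q ∘ Fin.suc) (all ∘ Fin.suc)

open FiniteSums

module OneSample where

  open import Data.Nat using (ℕ; zero; suc; _+_; _*_; _∸_; _<_; _<ᵇ_)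
  import Data.Nat.Properties as ℕP
  open import Data.Rational as ℚ using (ℚ; 0ℚ; 1ℚ)
  import Data.Rational.Properties as ℚP
  open import Data.Rational.Solver using (module +-*-Solver)
  open import Data.Bool using (Bool; true; false; _∧_; not; if_then_else_)
  open import Data.Fin using (Fin; toℕ)
  open import Data.Vec using ([]; _∷_)
  import Data.List as List
  open import Data.List using (allFin)
  open import Data.Product using (∃; _,_)
  open import Relation.Binary.PropositionalEquality hiding ([_])
  open +-*-Solver

  positive⇒suc : ∀ {m} → 0 < m → ∃ λ w → m ≡ suc w
  positive⇒suc {suc w} _ = w , refl

  guard-scale : ∀ b {x y : ℚ} (c : ℚ) → (b ≡ true → x ≡ c ℚ.* y) →
                (if b then x else 0ℚ) ≡ c ℚ.* (if b then y else 0ℚ)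
  guard-scale true  c eq = eq refl
  guard-scale false c eq = sym (ℚP.*-zeroʳ c)

  guard-+ : ∀ b (x y : ℚ) → (if b then x ℚ.+ y else 0ℚ) ≡ (if b then x else 0ℚ) ℚ.+ (if b then y else 0ℚ)
  guard-+ true  x y = refl
  guard-+ false x y = refl

  guard-Σ : ∀ {n} b (c : ℚ) (g : Fin n → ℚ) →
            (if b then c ℚ.* Σℚ g else 0ℚ) ≡ Σℚ (λ i → if b then c ℚ.* g i else 0ℚ)
  guard-Σ true  c g = ℚΣ.*-distribˡ-sum c g
  guard-Σ {n} false c g = sym (ℚΣ.sum-replicate-zero n)

  guard-ℕtoℚ : ∀ b x → (if b then ℕtoℚ x else 0ℚ) ≡ ℕtoℚ (if b then x else 0)
  guard-ℕtoℚ true  x = refl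
  guard-ℕtoℚ false x = refl

  nested-guards : ∀ e a a' (A B C x : ℚ) →
    (if e then A ℚ.* (if a then B ℚ.* (if a' then C ℚ.* x else 0ℚ) else 0ℚ) else 0ℚ)
    ≡ (if e ∧ (a ∧ a') then A ℚ.* (B ℚ.* (C ℚ.* x)) else 0ℚ)
  nested-guards false a     a'    A B C x = refl
  nested-guards true  false a'    A B C x = ℚP.*-zeroʳ A
  nested-guards true  true  false A B C x = trans (cong (A ℚ.*_) (ℚP.*-zeroʳ B)) (ℚP.*-zeroʳ A)
  nested-guards true  true  true  A B C x = refl

  -- The probabilities of the three random choices multiply to 1/W:
  -- τ_e/W · 1/(d_u-1) · 1/(d_v-1) = 1/W  when  d_u-1 = a+1, d_v-1 = b+1.
  cancel-weights : ∀ a b (w x : ℚ) →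
    (ℕtoℚ (suc a * suc b) ℚ.* w) ℚ.* (frac 1 (suc a) ℚ.* (frac 1 (suc b) ℚ.* x)) ≡ w ℚ.* x
  cancel-weights a b w x = begin
    (ℕtoℚ (suc a * suc b) ℚ.* w) ℚ.* (ia ℚ.* (ib ℚ.* x))
      ≡⟨ cong (λ z → (z ℚ.* w) ℚ.* (ia ℚ.* (ib ℚ.* x))) (ℕtoℚ-* (suc a) (suc b)) ⟩
    ((A ℚ.* B) ℚ.* w) ℚ.* (ia ℚ.* (ib ℚ.* x))
      ≡⟨ solve 6 (λ A B w ia ib x → ((A :* B) :* w) :* (ia :* (ib :* x))
                                    := ((ia :* A) :* (ib :* B)) :* (w :* x)) refl A B w ia ib x ⟩
    ((ia ℚ.* A) ℚ.* (ib ℚ.* B)) ℚ.* (w ℚ.* x)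
      ≡⟨ cong₂ (λ p q → (p ℚ.* q) ℚ.* (w ℚ.* x)) (frac-inv a) (frac-inv b) ⟩
    (1ℚ ℚ.* 1ℚ) ℚ.* (w ℚ.* x)
      ≡⟨ ℚP.*-identityˡ (w ℚ.* x) ⟩
    w ℚ.* x ∎
    where
    open ≡-Reasoning
    A B ia ib : ℚ
    A = ℕtoℚ (suc a)
    B = ℕtoℚ (suc b)
    ia = frac 1 (suc a)
    ib = frac 1 (suc b)

  module _ {n : ℕ} (G : Graph n) where

    extends : Fin n → Fin n → Fin n → Bool
    extends u v x = adj G u x ∧ not (eqFin x v)

    walk : Tup (Fin n) → Bool
    walk (u , v , u' , v') = isEdge G u v ∧ (extends u v u' ∧ extends v u v')

    outcome : Tup (Fin n) → Outcome G
    outcome (u , v , u' , v') = u' ∷ u ∷ v ∷ v' ∷ []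

    walkTerm : (Outcome G → ℚ) → Tup (Fin n) → ℚ
    walkTerm f t = if walk t then f (outcome t) else 0ℚ

    walkSum : (Outcome G → ℚ) → ℚ
    walkSum f = ℚΣ⁴.Σ⁴ (walkTerm f)

    isEdge⇒adj : ∀ u v → isEdge G u v ≡ true → adj G u v ≡ true
    isEdge⇒adj u v e with toℕ u <ᵇ toℕ v
    ... | true = e

    extends-count : ∀ u v → adj G u v ≡ true → Σℕ (λ x → [ extends u v x ]) ≡ deg G u ∸ 1
    extends-count u v uv = begin
      others                                ≡⟨ ℕP.m+n∸n≡m others 1 ⟨
      others + 1 ∸ 1                        ≡⟨ cong (λ b → others + [ b ] ∸ 1) uv ⟨
      others + [ adj G u v ] ∸ 1            ≡⟨ cong (_∸ 1) (count-remove (adj G u) v) ⟨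
      Σℕ (λ x → [ adj G u x ]) ∸ 1          ≡⟨ cong (_∸ 1) (countFin≡Σ (adj G u)) ⟨
      deg G u ∸ 1                           ∎
      where
      open ≡-Reasoning
      others : ℕ
      others = Σℕ λ x → [ extends u v x ]

    walk-degree : ∀ u v x → adj G u v ≡ true → extends u v x ≡ true → ∃ λ a → deg G u ∸ 1 ≡ suc a
    walk-degree u v x uv ux = _ , trans (sym (extends-count u v uv)) (count-suc (extends u v) x ux)

    edgeWeight : Fin n → Fin n → ℚ
    edgeWeight u v = frac (τ G u v) (W G)

    stepWeight : Fin n → ℚ
    stepWeight u = frac 1 (deg G u ∸ 1)

    -- Every run of `sample` has the same probability 1/W.
    walk-weight : ∀ t x → walk t ≡ true →
      let (u , v , _ , _) = t in
      edgeWeight u v ℚ.* (stepWeight u ℚ.* (stepWeight v ℚ.* x)) ≡ frac 1 (W G) ℚ.* x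
    walk-weight (u , v , u' , v') x w
      with isEdge G u v in uv | extends u v u' in uu' | extends v u v' in vv'
    ... | true | true | true
      with walk-degree u v u' (isEdge⇒adj u v uv) uu'
         | walk-degree v u v' (trans (adj-sym G v u) (isEdge⇒adj u v uv)) vv'
    ... | a , du | b , dv = begin
      frac ((deg G u ∸ 1) * (deg G v ∸ 1)) (W G) ℚ.* (stepWeight u ℚ.* (stepWeight v ℚ.* x))
        ≡⟨ cong (ℚ._* (stepWeight u ℚ.* (stepWeight v ℚ.* x))) (frac-split _ (W G)) ⟩
      (ℕtoℚ ((deg G u ∸ 1) * (deg G v ∸ 1)) ℚ.* frac 1 (W G)) ℚ.* (stepWeight u ℚ.* (stepWeight v ℚ.* x))
        ≡⟨ cong₂ (λ p q → (ℕtoℚ (p * q) ℚ.* frac 1 (W G)) ℚ.* (frac 1 p ℚ.* (frac 1 q ℚ.* x))) du dv ⟩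
      (ℕtoℚ (suc a * suc b) ℚ.* frac 1 (W G)) ℚ.* (frac 1 (suc a) ℚ.* (frac 1 (suc b) ℚ.* x))
        ≡⟨ cancel-weights a b (frac 1 (W G)) x ⟩
      frac 1 (W G) ℚ.* x ∎
      where open ≡-Reasoning

    guarded-sumFin : ∀ b (c : ℚ) (g : Fin n → ℚ) →
                     (if b then c ℚ.* sumFin g else 0ℚ) ≡ Σℚ (λ i → if b then c ℚ.* g i else 0ℚ)
    guarded-sumFin b c g = trans (cong (λ s → if b then c ℚ.* s else 0ℚ) (sumFin≡Σ g)) (guard-Σ b c g)

    thirdChoice : (Outcome G → ℚ) → Fin n → Fin n → Fin n → Fin n → ℚ
    thirdChoice f u v u' v' = if extends v u v' then stepWeight v ℚ.* f (outcome (u , v , u' , v')) else 0ℚ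

    secondChoice : (Outcome G → ℚ) → Fin n → Fin n → Fin n → ℚ
    secondChoice f u v u' = if extends u v u' then stepWeight u ℚ.* sumFin (thirdChoice f u v u') else 0ℚ

    firstChoice : (Outcome G → ℚ) → Fin n → Fin n → ℚ
    firstChoice f u v = if isEdge G u v then edgeWeight u v ℚ.* sumFin (secondChoice f u v) else 0ℚ

    nestedTerm : (Outcome G → ℚ) → Tup (Fin n) → ℚ
    nestedTerm f (u , v , u' , v') =
      if isEdge G u v then edgeWeight u v ℚ.*
        (if extends u v u' then stepWeight u ℚ.* thirdChoice f u v u' v' else 0ℚ) else 0ℚ

    E₁-flatten : ∀ f → E₁ G f ≡ ℚΣ⁴.Σ⁴ (nestedTerm f)
    E₁-flatten f =
      trans (sumFin≡Σ λ u → sumFin (firstChoice f u)) (ℚΣ.sum-cong-≗ λ u →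
      trans (sumFin≡Σ (firstChoice f u)) (ℚΣ.sum-cong-≗ λ v →
      trans (guarded-sumFin (isEdge G u v) (edgeWeight u v) (secondChoice f u v)) (ℚΣ.sum-cong-≗ λ u' →
      trans (cong (λ s → if isEdge G u v then edgeWeight u v ℚ.* s else 0ℚ)
                  (guarded-sumFin (extends u v u') (stepWeight u) (thirdChoice f u v u')))
            (guard-Σ (isEdge G u v) (edgeWeight u v)
                     (λ v' → if extends u v u' then stepWeight u ℚ.* thirdChoice f u v u' v' else 0ℚ)))))

    -- Sampling identity: a run of `sample` is a uniformly random walk.
    E₁-walkSum : ∀ f → E₁ G f ≡ frac 1 (W G) ℚ.* walkSum f
    E₁-walkSum f = begin
      E₁ G f                                                         ≡⟨ E₁-flatten f ⟩
      ℚΣ⁴.Σ⁴ (nestedTerm f)                                          ≡⟨ ℚΣ⁴.Σ⁴-cong term ⟩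
      ℚΣ⁴.Σ⁴ (λ t → frac 1 (W G) ℚ.* walkTerm f t)
                                                                     ≡⟨ ℚΣ⁴.Σ⁴-*ˡ (frac 1 (W G)) (walkTerm f) ⟩
      frac 1 (W G) ℚ.* walkSum f                                     ∎
      where
      open ≡-Reasoning
      term : ∀ t → nestedTerm f t ≡ frac 1 (W G) ℚ.* walkTerm f t
      term t@(u , v , u' , v') =
        trans (nested-guards (isEdge G u v) (extends u v u') (extends v u v')
                             (edgeWeight u v) (stepWeight u) (stepWeight v) (f (outcome t)))
              (guard-scale (walk t) (frac 1 (W G)) (walk-weight t (f (outcome t))))

    walkSum-cong : ∀ {f g} → (∀ s → f s ≡ g s) → walkSum f ≡ walkSum g
    walkSum-cong f≗g = ℚΣ⁴.Σ⁴-cong λ t → cong (λ z → if walk t then z else 0ℚ) (f≗g (outcome t))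

    E₁-cong : ∀ {f g} → (∀ s → f s ≡ g s) → E₁ G f ≡ E₁ G g
    E₁-cong {f} {g} f≗g = begin
      E₁ G f                       ≡⟨ E₁-walkSum f ⟩
      frac 1 (W G) ℚ.* walkSum f   ≡⟨ cong (frac 1 (W G) ℚ.*_) (walkSum-cong f≗g) ⟩
      frac 1 (W G) ℚ.* walkSum g   ≡⟨ E₁-walkSum g ⟨
      E₁ G g                       ∎
      where open ≡-Reasoning

    E₁-+ : ∀ f g → E₁ G (λ s → f s ℚ.+ g s) ≡ E₁ G f ℚ.+ E₁ G g
    E₁-+ f g = begin
      E₁ G (λ s → f s ℚ.+ g s)
        ≡⟨ E₁-walkSum (λ s → f s ℚ.+ g s) ⟩
      w ℚ.* ℚΣ⁴.Σ⁴ (walkTerm λ s → f s ℚ.+ g s)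
        ≡⟨ cong (w ℚ.*_) (ℚΣ⁴.Σ⁴-cong λ t → guard-+ (walk t) (f (outcome t)) (g (outcome t))) ⟩
      w ℚ.* ℚΣ⁴.Σ⁴ (λ t → walkTerm f t ℚ.+ walkTerm g t)
        ≡⟨ cong (w ℚ.*_) (ℚΣ⁴.Σ⁴-+ (walkTerm f) (walkTerm g)) ⟩
      w ℚ.* (walkSum f ℚ.+ walkSum g)
        ≡⟨ ℚP.*-distribˡ-+ w (walkSum f) (walkSum g) ⟩
      w ℚ.* walkSum f ℚ.+ w ℚ.* walkSum g
        ≡⟨ cong₂ ℚ._+_ (E₁-walkSum f) (E₁-walkSum g) ⟨
      E₁ G f ℚ.+ E₁ G g ∎
      where
      open ≡-Reasoning
      w : ℚ
      w = frac 1 (W G)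

    E₁-* : ∀ c f → E₁ G (λ s → c ℚ.* f s) ≡ c ℚ.* E₁ G f
    E₁-* c f = begin
      E₁ G (λ s → c ℚ.* f s)
        ≡⟨ E₁-walkSum (λ s → c ℚ.* f s) ⟩
      w ℚ.* ℚΣ⁴.Σ⁴ (walkTerm λ s → c ℚ.* f s)
        ≡⟨ cong (w ℚ.*_) (ℚΣ⁴.Σ⁴-cong λ t → guard-scale (walk t) c (λ _ → refl)) ⟩
      w ℚ.* ℚΣ⁴.Σ⁴ (λ t → c ℚ.* walkTerm f t)
        ≡⟨ cong (w ℚ.*_) (ℚΣ⁴.Σ⁴-*ˡ c (walkTerm f)) ⟩
      w ℚ.* (c ℚ.* walkSum f)
        ≡⟨ solve 3 (λ w c s → w :* (c :* s) := c :* (w :* s)) refl w c (walkSum f) ⟩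
      c ℚ.* (w ℚ.* walkSum f)
        ≡⟨ cong (c ℚ.*_) (E₁-walkSum f) ⟨
      c ℚ.* E₁ G f ∎
      where
      open ≡-Reasoning
      w : ℚ
      w = frac 1 (W G)

    walkCount : ℕ
    walkCount = ℕΣ⁴.Σ⁴ λ t → [ walk t ]

    walks-through : ∀ u v → (Σℕ λ u' → Σℕ λ v' → [ walk (u , v , u' , v') ]) ≡ (if isEdge G u v then τ G u v else 0)
    walks-through u v with isEdge G u v in uv
    ... | false = trans (ℕΣ.sum-cong-≗ {n} {x = λ _ → Σℕ {n} λ _ → 0} λ _ → ℕΣ.sum-replicate-zero n)
                        (ℕΣ.sum-replicate-zero n)
    ... | true  = begin
      (Σℕ λ u' → Σℕ λ v' → [ extends u v u' ∧ extends v u v' ])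
        ≡⟨ ℕΣ.sum-cong-≗ (λ u' → ℕΣ.sum-cong-≗ λ v' → [∧]≡[]*[] (extends u v u') (extends v u v')) ⟩
      (Σℕ λ u' → Σℕ λ v' → [ extends u v u' ] * [ extends v u v' ])
        ≡⟨ Σ-product (λ u' → [ extends u v u' ]) (λ v' → [ extends v u v' ]) ⟩
      Σℕ (λ u' → [ extends u v u' ]) * Σℕ (λ v' → [ extends v u v' ])
        ≡⟨ cong₂ _*_ (extends-count u v (isEdge⇒adj u v uv))
                     (extends-count v u (trans (adj-sym G v u) (isEdge⇒adj u v uv))) ⟩
      (deg G u ∸ 1) * (deg G v ∸ 1) ∎
      where open ≡-Reasoning

    walkCount≡W : walkCount ≡ W G
    walkCount≡W = sym (begin
      W G
        ≡⟨ foldr-map≡Σ (λ u → List.foldr _+_ 0 (List.map (edgeTerm u) (allFin n))) ⟩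
      Σℕ (λ u → List.foldr _+_ 0 (List.map (edgeTerm u) (allFin n)))
        ≡⟨ ℕΣ.sum-cong-≗ (λ u → foldr-map≡Σ (edgeTerm u)) ⟩
      Σℕ (λ u → Σℕ (edgeTerm u))
        ≡⟨ ℕΣ.sum-cong-≗ (λ u → ℕΣ.sum-cong-≗ λ v → walks-through u v) ⟨
      walkCount ∎)
      where
      open ≡-Reasoning
      edgeTerm : Fin n → Fin n → ℕ
      edgeTerm u v = if isEdge G u v then τ G u v else 0

    -- Hence E₁ fixes constants (this is where W > 0 is needed).
    walkSum-const : ∀ c → walkSum (λ _ → c) ≡ c ℚ.* ℕtoℚ walkCount
    walkSum-const c = begin
      walkSum (λ _ → c)                         ≡⟨ ℚΣ⁴.Σ⁴-cong (λ t → guard (walk t)) ⟩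
      ℚΣ⁴.Σ⁴ (λ t → c ℚ.* ℕtoℚ [ walk t ])      ≡⟨ ℚΣ⁴.Σ⁴-*ˡ c (λ t → ℕtoℚ [ walk t ]) ⟩
      c ℚ.* ℚΣ⁴.Σ⁴ (λ t → ℕtoℚ [ walk t ])      ≡⟨ cong (c ℚ.*_) (ℕtoℚ-Σ⁴ λ t → [ walk t ]) ⟨
      c ℚ.* ℕtoℚ walkCount                      ∎
      where
      open ≡-Reasoning
      guard : ∀ b → (if b then c else 0ℚ) ≡ c ℚ.* ℕtoℚ [ b ]
      guard true  = sym (ℚP.*-identityʳ c)
      guard false = sym (ℚP.*-zeroʳ c)

    E₁-const : 0 < W G → ∀ c → E₁ G (λ _ → c) ≡ c
    E₁-const W>0 c with positive⇒suc W>0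
    ... | w , eqW = begin
      E₁ G (λ _ → c)                                    ≡⟨ E₁-walkSum (λ _ → c) ⟩
      frac 1 (W G) ℚ.* walkSum (λ _ → c)                ≡⟨ cong₂ ℚ._*_ (cong (frac 1) eqW) (walkSum-const c) ⟩
      frac 1 (suc w) ℚ.* (c ℚ.* ℕtoℚ walkCount)
                                                        ≡⟨ cong (λ z → frac 1 (suc w) ℚ.* (c ℚ.* ℕtoℚ z)) (trans walkCount≡W eqW) ⟩
      frac 1 (suc w) ℚ.* (c ℚ.* ℕtoℚ (suc w))
                                                        ≡⟨ solve 3 (λ i c N → i :* (c :* N) := (i :* N) :* c)
                                                                 refl (frac 1 (suc w)) c (ℕtoℚ (suc w)) ⟩
      (frac 1 (suc w) ℚ.* ℕtoℚ (suc w)) ℚ.* c            ≡⟨ cong (ℚ._* c) (frac-inv w) ⟩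
      1ℚ ℚ.* c                                          ≡⟨ ℚP.*-identityˡ c ⟩
      c                                                 ∎
      where open ≡-Reasoning

    E₁-indicator : ∀ (P : Outcome G → Bool) →
      E₁ G (λ s → ℕtoℚ [ P s ]) ≡ frac 1 (W G) ℚ.* ℕtoℚ (ℕΣ⁴.Σ⁴ λ t → [ walk t ∧ P (outcome t) ])
    E₁-indicator P = begin
      E₁ G (λ s → ℕtoℚ [ P s ])
        ≡⟨ E₁-walkSum (λ s → ℕtoℚ [ P s ]) ⟩
      frac 1 (W G) ℚ.* walkSum (λ s → ℕtoℚ [ P s ])
        ≡⟨ cong (frac 1 (W G) ℚ.*_) (ℚΣ⁴.Σ⁴-cong λ t →
             trans (guard-ℕtoℚ (walk t) [ P (outcome t) ]) (cong ℕtoℚ (guard-[] (walk t) (P (outcome t))))) ⟩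
      frac 1 (W G) ℚ.* ℚΣ⁴.Σ⁴ (λ t → ℕtoℚ [ walk t ∧ P (outcome t) ])
        ≡⟨ cong (frac 1 (W G) ℚ.*_) (ℕtoℚ-Σ⁴ λ t → [ walk t ∧ P (outcome t) ]) ⟨
      frac 1 (W G) ℚ.* ℕtoℚ (ℕΣ⁴.Σ⁴ λ t → [ walk t ∧ P (outcome t) ]) ∎
      where open ≡-Reasoning

open OneSample

module RepeatedSampling where

  open import Data.Nat using (ℕ; zero; suc; _+_; _<_; _≥_)
  open import Data.Rational as ℚ using (ℚ; 1ℚ)
  import Data.Rational.Properties as ℚP
  open import Data.Rational.Solver using (module +-*-Solver)
  open import Data.Bool using (true; false)
  open import Data.Vec using (Vec; []; _∷_)
  open import Relation.Binary.PropositionalEquality hiding ([_])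
  open +-*-Solver

  module _ {n : ℕ} (G : Graph n) where

    Eₖ-cong : ∀ k {g h} → (∀ xs → g xs ≡ h xs) → Eₖ G k g ≡ Eₖ G k h
    Eₖ-cong zero    g≗h = g≗h []
    Eₖ-cong (suc k) g≗h = E₁-cong G λ x → Eₖ-cong k λ xs → g≗h (x ∷ xs)

    Eₖ-+ : ∀ k g h → Eₖ G k (λ xs → g xs ℚ.+ h xs) ≡ Eₖ G k g ℚ.+ Eₖ G k h
    Eₖ-+ zero    g h = refl
    Eₖ-+ (suc k) g h = trans (E₁-cong G λ x → Eₖ-+ k (λ xs → g (x ∷ xs)) (λ xs → h (x ∷ xs)))
                             (E₁-+ G (λ x → Eₖ G k λ xs → g (x ∷ xs)) (λ x → Eₖ G k λ xs → h (x ∷ xs)))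

    Eₖ-* : ∀ k c g → Eₖ G k (λ xs → c ℚ.* g xs) ≡ c ℚ.* Eₖ G k g
    Eₖ-* zero    c g = refl
    Eₖ-* (suc k) c g = trans (E₁-cong G λ x → Eₖ-* k c λ xs → g (x ∷ xs))
                             (E₁-* G c λ x → Eₖ G k λ xs → g (x ∷ xs))

    Eₖ-- : ∀ k g h → Eₖ G k (λ xs → g xs ℚ.- h xs) ≡ Eₖ G k g ℚ.- Eₖ G k h
    Eₖ-- k g h = begin
      Eₖ G k (λ xs → g xs ℚ.- h xs)                 ≡⟨ Eₖ-cong k (λ xs → neg (g xs) (h xs)) ⟩
      Eₖ G k (λ xs → g xs ℚ.+ (ℚ.- 1ℚ) ℚ.* h xs)    ≡⟨ Eₖ-+ k g (λ xs → (ℚ.- 1ℚ) ℚ.* h xs) ⟩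
      Eₖ G k g ℚ.+ Eₖ G k (λ xs → (ℚ.- 1ℚ) ℚ.* h xs) ≡⟨ cong (Eₖ G k g ℚ.+_) (Eₖ-* k (ℚ.- 1ℚ) h) ⟩
      Eₖ G k g ℚ.+ (ℚ.- 1ℚ) ℚ.* Eₖ G k h            ≡⟨ neg (Eₖ G k g) (Eₖ G k h) ⟨
      Eₖ G k g ℚ.- Eₖ G k h                         ∎
      where
      open ≡-Reasoning
      neg : ∀ x y → x ℚ.- y ≡ x ℚ.+ (ℚ.- 1ℚ) ℚ.* y
      neg = solve 2 (λ x y → x :- y := x :+ (:- con 1ℚ) :* y) refl

    motifProbability : Motif → ℚ
    motifProbability m = E₁ G λ s → ℕtoℚ [ isMotif G m s ]

    count-cons : ∀ {k} m s (xs : Vec (Outcome G) k) → count G m (s ∷ xs) ≡ [ isMotif G m s ] + count G m xs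
    count-cons m s xs with isMotif G m s
    ... | true  = refl
    ... | false = refl

    module _ (W>0 : 0 < W G) where

      Eₖ-const : ∀ k c → Eₖ G k (λ _ → c) ≡ c
      Eₖ-const zero    c = refl
      Eₖ-const (suc k) c = trans (E₁-cong G λ _ → Eₖ-const k c) (E₁-const G W>0 c)

      -- count_i is a sum of k independent indicators.
      Eₖ-count : ∀ k m → Eₖ G k (λ xs → ℕtoℚ (count G m xs)) ≡ ℕtoℚ k ℚ.* motifProbability m
      Eₖ-count zero    m = sym (ℚP.*-zeroˡ (motifProbability m))
      Eₖ-count (suc k) m = begin
        E₁ G (λ x → Eₖ G k λ xs → ℕtoℚ (count G m (x ∷ xs)))
          ≡⟨ E₁-cong G (λ x → step x) ⟩
        E₁ G (λ x → ℕtoℚ [ isMotif G m x ] ℚ.+ ℕtoℚ k ℚ.* p)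
          ≡⟨ E₁-+ G (λ x → ℕtoℚ [ isMotif G m x ]) (λ _ → ℕtoℚ k ℚ.* p) ⟩
        p ℚ.+ E₁ G (λ _ → ℕtoℚ k ℚ.* p)
          ≡⟨ cong (p ℚ.+_) (E₁-const G W>0 (ℕtoℚ k ℚ.* p)) ⟩
        p ℚ.+ ℕtoℚ k ℚ.* p
          ≡⟨ solve 2 (λ p K → p :+ K :* p := (con 1ℚ :+ K) :* p) refl p (ℕtoℚ k) ⟩
        (ℕtoℚ 1 ℚ.+ ℕtoℚ k) ℚ.* p
          ≡⟨ cong (ℚ._* p) (ℕtoℚ-+ 1 k) ⟨
        ℕtoℚ (suc k) ℚ.* p ∎
        where
        open ≡-Reasoning
        p : ℚ
        p = motifProbability m
        step : ∀ x → Eₖ G k (λ xs → ℕtoℚ (count G m (x ∷ xs))) ≡ ℕtoℚ [ isMotif G m x ] ℚ.+ ℕtoℚ k ℚ.* p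
        step x = begin
          Eₖ G k (λ xs → ℕtoℚ (count G m (x ∷ xs)))
            ≡⟨ Eₖ-cong k (λ xs → trans (cong ℕtoℚ (count-cons m x xs)) (ℕtoℚ-+ [ isMotif G m x ] (count G m xs))) ⟩
          Eₖ G k (λ xs → ℕtoℚ [ isMotif G m x ] ℚ.+ ℕtoℚ (count G m xs))
            ≡⟨ Eₖ-+ k (λ _ → ℕtoℚ [ isMotif G m x ]) (λ xs → ℕtoℚ (count G m xs)) ⟩
          Eₖ G k (λ _ → ℕtoℚ [ isMotif G m x ]) ℚ.+ Eₖ G k (λ xs → ℕtoℚ (count G m xs))
            ≡⟨ cong₂ ℚ._+_ (Eₖ-const k _) (Eₖ-count k m) ⟩
          ℕtoℚ [ isMotif G m x ] ℚ.+ ℕtoℚ k ℚ.* p ∎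

      Eₖ-Ĉ' : ∀ k → k ≥ 1 → ∀ m → Eₖ G k (Ĉ' G m) ≡ frac (W G) (A₂ m) ℚ.* motifProbability m
      Eₖ-Ĉ' (suc k) _ m = begin
        Eₖ G (suc k) (λ xs → frac (count G m xs) (suc k) ℚ.* r)
          ≡⟨ Eₖ-cong (suc k) (λ xs → trans (cong (ℚ._* r) (frac-split (count G m xs) (suc k)))
               (solve 3 (λ a b c → (a :* b) :* c := (b :* c) :* a) refl (ℕtoℚ (count G m xs)) i r)) ⟩
        Eₖ G (suc k) (λ xs → (i ℚ.* r) ℚ.* ℕtoℚ (count G m xs))
          ≡⟨ Eₖ-* (suc k) (i ℚ.* r) (λ xs → ℕtoℚ (count G m xs)) ⟩
        (i ℚ.* r) ℚ.* Eₖ G (suc k) (λ xs → ℕtoℚ (count G m xs))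
          ≡⟨ cong ((i ℚ.* r) ℚ.*_) (Eₖ-count (suc k) m) ⟩
        (i ℚ.* r) ℚ.* (ℕtoℚ (suc k) ℚ.* p)
          ≡⟨ solve 4 (λ i r K p → (i :* r) :* (K :* p) := (i :* K) :* (r :* p)) refl i r (ℕtoℚ (suc k)) p ⟩
        (i ℚ.* ℕtoℚ (suc k)) ℚ.* (r ℚ.* p)
          ≡⟨ cong (ℚ._* (r ℚ.* p)) (frac-inv k) ⟩
        1ℚ ℚ.* (r ℚ.* p)
          ≡⟨ ℚP.*-identityˡ (r ℚ.* p) ⟩
        r ℚ.* p ∎
        where
        open ≡-Reasoning
        i r p : ℚ
        i = frac 1 (suc k)
        r = frac (W G) (A₂ m)
        p = motifProbability m

open RepeatedSampling

module TuplePermutations where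

  open import Data.Nat using (ℕ; _+_; _*_)
  import Data.Nat.Properties as ℕP
  open import Data.Fin using (Fin)
  open import Data.List using (List; []; _∷_; _++_; _∷ʳ_; reverse)
  import Data.List.Properties as ListP
  open import Data.Product using (_,_)
  open import Relation.Binary.PropositionalEquality hiding ([_])

  data Transposition : Set where
    swap₀₁ swap₁₂ swap₂₃ : Transposition

  transpose : ∀ {A : Set} → Transposition → Tup A → Tup A
  transpose swap₀₁ (a , b , c , d) = b , a , c , d
  transpose swap₁₂ (a , b , c , d) = a , c , b , d
  transpose swap₂₃ (a , b , c , d) = a , b , d , c

  permute : ∀ {A : Set} → List Transposition → Tup A → Tup A
  permute []      t = t
  permute (g ∷ w) t = permute w (transpose g t)

  permute-++ : ∀ {A : Set} (w v : List Transposition) (t : Tup A) → permute (w ++ v) t ≡ permute v (permute w t)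
  permute-++ []      v t = refl
  permute-++ (g ∷ w) v t = permute-++ w v (transpose g t)

  transpose-involutive : ∀ {A : Set} g (t : Tup A) → transpose g (transpose g t) ≡ t
  transpose-involutive swap₀₁ t = refl
  transpose-involutive swap₁₂ t = refl
  transpose-involutive swap₂₃ t = refl

  permute-reverse : ∀ {A : Set} (w : List Transposition) (t : Tup A) → permute w (permute (reverse w) t) ≡ t
  permute-reverse []      t = refl
  permute-reverse (g ∷ w) t = begin
    permute w (transpose g (permute (reverse (g ∷ w)) t))
      ≡⟨ cong (λ v → permute w (transpose g (permute v t))) (ListP.unfold-reverse g w) ⟩
    permute w (transpose g (permute (reverse w ∷ʳ g) t))
      ≡⟨ cong (λ s → permute w (transpose g s)) (permute-++ (reverse w) (g ∷ []) t) ⟩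
    permute w (transpose g (transpose g (permute (reverse w) t)))
      ≡⟨ cong (permute w) (transpose-involutive g (permute (reverse w) t)) ⟩
    permute w (permute (reverse w) t)
      ≡⟨ permute-reverse w t ⟩
    t ∎
    where open ≡-Reasoning

  mapTup : ∀ {A B : Set} → (A → B) → Tup A → Tup B
  mapTup f (a , b , c , d) = f a , f b , f c , f d

  permute-map : ∀ {A B : Set} (f : A → B) (w : List Transposition) (t : Tup A) →
                permute w (mapTup f t) ≡ mapTup f (permute w t)
  permute-map f []           t = refl
  permute-map f (swap₀₁ ∷ w) t = permute-map f w (transpose swap₀₁ t)
  permute-map f (swap₁₂ ∷ w) t = permute-map f w (transpose swap₁₂ t)
  permute-map f (swap₂₃ ∷ w) t = permute-map f w (transpose swap₂₃ t)

  permutations : List (List Transposition)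
  permutations =
    [] ∷ (swap₀₁ ∷ []) ∷ (swap₁₂ ∷ []) ∷ (swap₂₃ ∷ []) ∷ (swap₀₁ ∷ swap₁₂ ∷ []) ∷
    (swap₀₁ ∷ swap₂₃ ∷ []) ∷ (swap₁₂ ∷ swap₀₁ ∷ []) ∷ (swap₁₂ ∷ swap₂₃ ∷ []) ∷
    (swap₂₃ ∷ swap₁₂ ∷ []) ∷ (swap₀₁ ∷ swap₁₂ ∷ swap₀₁ ∷ []) ∷ (swap₀₁ ∷ swap₁₂ ∷ swap₂₃ ∷ []) ∷
    (swap₀₁ ∷ swap₂₃ ∷ swap₁₂ ∷ []) ∷ (swap₁₂ ∷ swap₀₁ ∷ swap₂₃ ∷ []) ∷
    (swap₁₂ ∷ swap₂₃ ∷ swap₁₂ ∷ []) ∷ (swap₂₃ ∷ swap₁₂ ∷ swap₀₁ ∷ []) ∷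
    (swap₀₁ ∷ swap₁₂ ∷ swap₀₁ ∷ swap₂₃ ∷ []) ∷ (swap₀₁ ∷ swap₁₂ ∷ swap₂₃ ∷ swap₁₂ ∷ []) ∷
    (swap₀₁ ∷ swap₂₃ ∷ swap₁₂ ∷ swap₀₁ ∷ []) ∷ (swap₁₂ ∷ swap₀₁ ∷ swap₂₃ ∷ swap₁₂ ∷ []) ∷
    (swap₁₂ ∷ swap₂₃ ∷ swap₁₂ ∷ swap₀₁ ∷ []) ∷
    (swap₀₁ ∷ swap₁₂ ∷ swap₀₁ ∷ swap₂₃ ∷ swap₁₂ ∷ []) ∷
    (swap₀₁ ∷ swap₁₂ ∷ swap₂₃ ∷ swap₁₂ ∷ swap₀₁ ∷ []) ∷
    (swap₁₂ ∷ swap₀₁ ∷ swap₂₃ ∷ swap₁₂ ∷ swap₀₁ ∷ []) ∷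
    (swap₀₁ ∷ swap₁₂ ∷ swap₀₁ ∷ swap₂₃ ∷ swap₁₂ ∷ swap₀₁ ∷ []) ∷ []

  sumOver : ∀ {A : Set} → (A → ℕ) → List A → ℕ
  sumOver f []       = 0
  sumOver f (x ∷ xs) = f x + sumOver f xs

  sumOver-cong : ∀ {A : Set} {f g : A → ℕ} (xs : List A) → (∀ x → f x ≡ g x) → sumOver f xs ≡ sumOver g xs
  sumOver-cong []       f≗g = refl
  sumOver-cong (x ∷ xs) f≗g = cong₂ _+_ (f≗g x) (sumOver-cong xs f≗g)

  sumOver-*ʳ : ∀ {A : Set} (f : A → ℕ) (xs : List A) c → sumOver f xs * c ≡ sumOver (λ x → f x * c) xs
  sumOver-*ʳ f []       c = refl
  sumOver-*ʳ f (x ∷ xs) c = trans (ℕP.*-distribʳ-+ c (f x) (sumOver f xs)) (cong (f x * c +_) (sumOver-*ʳ f xs c))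

  sumOver-*ˡ : ∀ {A : Set} c (f : A → ℕ) (xs : List A) → c * sumOver f xs ≡ sumOver (λ x → c * f x) xs
  sumOver-*ˡ c f []       = ℕP.*-zeroʳ c
  sumOver-*ˡ c f (x ∷ xs) = trans (ℕP.*-distribˡ-+ c (f x) (sumOver f xs)) (cong (c * f x +_) (sumOver-*ˡ c f xs))

  open ℕΣ⁴ using (Σ⁴; Σ⁴-cong; Σ⁴-+)

  Σ⁴-sumOver : ∀ {n} {A : Set} (xs : List A) (F : A → Tup (Fin n) → ℕ) →
               Σ⁴ (λ t → sumOver (λ x → F x t) xs) ≡ sumOver (λ x → Σ⁴ (F x)) xs
  Σ⁴-sumOver {n} []       F = ℕΣ⁴.Σ⁴-*ˡ {n} 0 (λ _ → 0)
  Σ⁴-sumOver (x ∷ xs) F = trans (Σ⁴-+ (F x) (λ t → sumOver (λ y → F y t) xs))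
                                (cong (Σ⁴ (F x) +_) (Σ⁴-sumOver xs F))

  Σ⁴-transpose : ∀ {n} g (F : Tup (Fin n) → ℕ) → Σ⁴ F ≡ Σ⁴ (λ t → F (transpose g t))
  Σ⁴-transpose swap₀₁ F = ℕΣ.∑-comm λ a b → Σℕ λ c → Σℕ λ d → F (a , b , c , d)
  Σ⁴-transpose swap₁₂ F = ℕΣ.sum-cong-≗ λ a → ℕΣ.∑-comm λ b c → Σℕ λ d → F (a , b , c , d)
  Σ⁴-transpose swap₂₃ F = ℕΣ.sum-cong-≗ λ a → ℕΣ.sum-cong-≗ λ b → ℕΣ.∑-comm λ c d → F (a , b , c , d)

  Σ⁴-permute : ∀ {n} (w : List Transposition) (F : Tup (Fin n) → ℕ) → Σ⁴ F ≡ Σ⁴ (λ t → F (permute w t))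
  Σ⁴-permute []      F = refl
  Σ⁴-permute (g ∷ w) F = trans (Σ⁴-permute w F) (Σ⁴-transpose g (λ t → F (permute w t)))

open TuplePermutations

module SortingTuples where

  open import Data.Nat as ℕ using (ℕ; zero; suc; _<ᵇ_; _≡ᵇ_)
  import Data.Nat.Properties as ℕP
  open import Data.Bool using (Bool; true; false; _∧_; _∨_; not)
  import Data.Bool.Properties as BoolP
  open import Data.Fin as Fin using (Fin; toℕ)
  open import Data.Fin.Patterns using (0F; 1F; 2F; 3F)
  import Data.Fin.Properties as FinP
  open import Data.Vec using (Vec; []; _∷_)
  open import Data.List using (List; reverse)
  open import Data.Product using (_,_)
  open import Data.Empty using (⊥-elim)
  open import Function.Bundles using (Equivalence)
  open import Relation.Nullary using (yes; no)
  open import Relation.Binary.Definitions using (tri<; tri≈; tri>)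
  open import Relation.Binary.PropositionalEquality hiding ([_])

  allBits : ∀ k → (Vec Bool k → Bool) → Bool
  allBits zero    f = f []
  allBits (suc k) f = allBits k (λ v → f (true ∷ v)) ∧ allBits k (λ v → f (false ∷ v))

  ∧-elimˡ : ∀ {a b} → a ∧ b ≡ true → a ≡ true
  ∧-elimˡ {true} _ = refl

  ∧-elimʳ : ∀ {a b} → a ∧ b ≡ true → b ≡ true
  ∧-elimʳ {true} ab = ab

  allBits-sound : ∀ k f → allBits k f ≡ true → ∀ v → f v ≡ true
  allBits-sound zero    f ok []         = ok
  allBits-sound (suc k) f ok (true ∷ v)  = allBits-sound k (λ v → f (true ∷ v)) (∧-elimˡ ok) v
  allBits-sound (suc k) f ok (false ∷ v) = allBits-sound k (λ v → f (false ∷ v)) (∧-elimʳ ok) v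

  ≡ᵇ-sound : ∀ m n → (m ≡ᵇ n) ≡ true → m ≡ n
  ≡ᵇ-sound m n eq = ℕP.≡ᵇ⇒≡ m n (Equivalence.from BoolP.T-≡ eq)

  distinctBy : ∀ {I : Set} → (I → I → Bool) → Tup I → Bool
  distinctBy eq (a , b , c , d) =
    not (eq a b) ∧ not (eq a c) ∧ not (eq a d) ∧ not (eq b c) ∧ not (eq b d) ∧ not (eq c d)

  increasingBy : ∀ {I : Set} → (I → I → Bool) → Tup I → Bool
  increasingBy lt (a , b , c , d) = lt a b ∧ lt b c ∧ lt c d

  increasingBy-map : ∀ {I J : Set} (lt : J → J → Bool) (f : I → J) (t : Tup I) →
                     increasingBy lt (mapTup f t) ≡ increasingBy (λ i j → lt (f i) (f j)) t
  increasingBy-map lt f (a , b , c , d) = refl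

  incomparable : ∀ {I : Set} → (I → I → Bool) → I → I → Bool
  incomparable lt i j = not (lt i j) ∧ not (lt j i)

  distinctBy-cong : ∀ {I : Set} {e e' : I → I → Bool} → (∀ i j → e i j ≡ e' i j) →
                    ∀ t → distinctBy e t ≡ distinctBy e' t
  distinctBy-cong e≗e' (a , b , c , d)
    rewrite e≗e' a b | e≗e' a c | e≗e' a d | e≗e' b c | e≗e' b d | e≗e' c d = refl

  increasingBy-cong : ∀ {I : Set} {l l' : I → I → Bool} → (∀ i j → l i j ≡ l' i j) →
                      ∀ t → increasingBy l t ≡ increasingBy l' t
  increasingBy-cong l≗l' (a , b , c , d) rewrite l≗l' a b | l≗l' b c | l≗l' c d = refl

  ltFin : ∀ {n} → Fin n → Fin n → Bool
  ltFin a b = toℕ a <ᵇ toℕ b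

  distinct : ∀ {n} → Tup (Fin n) → Bool
  distinct = distinctBy eqFin

  increasing : ∀ {n} → Tup (Fin n) → Bool
  increasing = increasingBy ltFin

  <ᵇ-complete : ∀ {m n} → m ℕ.< n → (m <ᵇ n) ≡ true
  <ᵇ-complete m<n = Equivalence.to BoolP.T-≡ (ℕP.<⇒<ᵇ m<n)

  <ᵇ-sound : ∀ m n → (m <ᵇ n) ≡ true → m ℕ.< n
  <ᵇ-sound m n eq = ℕP.<ᵇ⇒< m n (Equivalence.from BoolP.T-≡ eq)

  <ᵇ-false : ∀ m n → n ℕ.≤ m → (m <ᵇ n) ≡ false
  <ᵇ-false m n n≤m with m <ᵇ n in eq
  ... | false = refl
  ... | true  = ⊥-elim (ℕP.<⇒≱ (<ᵇ-sound m n eq) n≤m)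

  eqFin-incomparable : ∀ {n} (a b : Fin n) → eqFin a b ≡ incomparable ltFin a b
  eqFin-incomparable a b with a Fin.≟ b | ℕP.<-cmp (toℕ a) (toℕ b)
  ... | yes refl | _ rewrite <ᵇ-false (toℕ a) (toℕ a) ℕP.≤-refl = refl
  ... | no  a≢b  | tri< a<b _ _ rewrite <ᵇ-complete a<b = refl
  ... | no  a≢b  | tri≈ _ a≡b _ = ⊥-elim (a≢b (FinP.toℕ-injective a≡b))
  ... | no  a≢b  | tri> _ _ b<a rewrite <ᵇ-complete b<a | <ᵇ-false (toℕ a) (toℕ b) (ℕP.<⇒≤ b<a) = refl

  strict-<ᵇ : ∀ x y z → ((not ((x <ᵇ y) ∧ (y <ᵇ z)) ∨ (x <ᵇ z)) ∧ not ((x <ᵇ y) ∧ (y <ᵇ x))) ≡ true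
  strict-<ᵇ x y z with x <ᵇ y in xy | y <ᵇ z in yz
  ... | false | _     = refl
  ... | true  | false rewrite <ᵇ-false y x (ℕP.<⇒≤ (<ᵇ-sound x y xy)) = refl
  ... | true  | true  rewrite <ᵇ-complete (ℕP.<-trans (<ᵇ-sound x y xy) (<ᵇ-sound y z yz))
                          | <ᵇ-false y x (ℕP.<⇒≤ (<ᵇ-sound x y xy)) = refl

  isStrictOrder : (Fin 4 → Fin 4 → Bool) → Bool
  isStrictOrder L = allFinB λ i → allFinB λ j → allFinB λ k →
    (not (L i j ∧ L j k) ∨ L i k) ∧ not (L i j ∧ L j i)

  isStrictOrder-cong : ∀ {L L'} → (∀ i j → L i j ≡ L' i j) → isStrictOrder L ≡ isStrictOrder L'
  isStrictOrder-cong L≗L' = allFinB-cong λ i → allFinB-cong λ j → allFinB-cong λ k →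
    cong₂ (λ p q → p ∧ q)
      (cong₂ (λ p q → not p ∨ q) (cong₂ _∧_ (L≗L' i j) (L≗L' j k)) (L≗L' i k))
      (cong not (cong₂ _∧_ (L≗L' i j) (L≗L' j i)))

  relationFromBits : Vec Bool 12 → Fin 4 → Fin 4 → Bool
  relationFromBits (b01 ∷ b02 ∷ b03 ∷ b10 ∷ b12 ∷ b13 ∷ b20 ∷ b21 ∷ b23 ∷ b30 ∷ b31 ∷ b32 ∷ []) = table
    where
    table : Fin 4 → Fin 4 → Bool
    table 0F 0F = false
    table 0F 1F = b01
    table 0F 2F = b02
    table 0F 3F = b03
    table 1F 0F = b10
    table 1F 1F = false
    table 1F 2F = b12
    table 1F 3F = b13
    table 2F 0F = b20
    table 2F 1F = b21
    table 2F 2F = false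
    table 2F 3F = b23
    table 3F 0F = b30
    table 3F 1F = b31
    table 3F 2F = b32
    table 3F 3F = false

  bitsOf : (Fin 4 → Fin 4 → Bool) → Vec Bool 12
  bitsOf L = L f0 f1 ∷ L f0 f2 ∷ L f0 f3 ∷ L f1 f0 ∷ L f1 f2 ∷ L f1 f3 ∷
             L f2 f0 ∷ L f2 f1 ∷ L f2 f3 ∷ L f3 f0 ∷ L f3 f1 ∷ L f3 f2 ∷ []

  relationFromBits-bitsOf : ∀ L → (∀ i → L i i ≡ false) → ∀ i j → L i j ≡ relationFromBits (bitsOf L) i j
  relationFromBits-bitsOf L irr 0F 0F = irr f0
  relationFromBits-bitsOf L irr 0F 1F = refl
  relationFromBits-bitsOf L irr 0F 2F = refl
  relationFromBits-bitsOf L irr 0F 3F = refl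
  relationFromBits-bitsOf L irr 1F 0F = refl
  relationFromBits-bitsOf L irr 1F 1F = irr f1
  relationFromBits-bitsOf L irr 1F 2F = refl
  relationFromBits-bitsOf L irr 1F 3F = refl
  relationFromBits-bitsOf L irr 2F 0F = refl
  relationFromBits-bitsOf L irr 2F 1F = refl
  relationFromBits-bitsOf L irr 2F 2F = irr f2
  relationFromBits-bitsOf L irr 2F 3F = refl
  relationFromBits-bitsOf L irr 3F 0F = refl
  relationFromBits-bitsOf L irr 3F 1F = refl
  relationFromBits-bitsOf L irr 3F 2F = refl
  relationFromBits-bitsOf L irr 3F 3F = irr f3

  positions : Tup (Fin 4)
  positions = f0 , f1 , f2 , f3

  -- For four pairwise comparable items exactly one permutation sorts them.
  uniqueSorting : (Fin 4 → Fin 4 → Bool) → Bool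
  uniqueSorting L = [ distinctBy (incomparable L) positions ] ≡ᵇ
                    sumOver (λ w → [ increasingBy L (permute (reverse w) positions) ]) permutations

  sortingProperty : Vec Bool 12 → Bool
  sortingProperty b = not (isStrictOrder (relationFromBits b)) ∨ uniqueSorting (relationFromBits b)

  sorting-check : allBits 12 sortingProperty ≡ true
  sorting-check = refl

  entry : ∀ {A : Set} → Tup A → Fin 4 → A
  entry (a , b , c , d) 0F = a
  entry (a , b , c , d) 1F = b
  entry (a , b , c , d) 2F = c
  entry (a , b , c , d) 3F = d

  entry-positions : ∀ {A : Set} (t : Tup A) → mapTup (entry t) positions ≡ t
  entry-positions (a , b , c , d) = refl

  ∨-elim : ∀ {a b} → not a ∨ b ≡ true → a ≡ true → b ≡ true
  ∨-elim {true} b refl = b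

  partition : ∀ {n} (t : Tup (Fin n)) →
              [ distinct t ] ≡ sumOver (λ w → [ increasing (permute (reverse w) t) ]) permutations
  partition t = begin
    [ distinct t ]
      ≡⟨ cong (λ s → [ distinct s ]) (entry-positions t) ⟨
    [ distinctBy (λ i j → eqFin (entry t i) (entry t j)) positions ]
      ≡⟨ cong [_] (distinctBy-cong (λ i j → trans (eqFin-incomparable (entry t i) (entry t j))
                                                (cong₂ (λ p q → not p ∧ not q) (L≈ i j) (L≈ j i))) positions) ⟩
    [ distinctBy (incomparable L) positions ]
      ≡⟨ ≡ᵇ-sound _ _ (∨-elim (allBits-sound 12 sortingProperty sorting-check (bitsOf order)) L-strict) ⟩
    sumOver (λ w → [ increasingBy L (permute (reverse w) positions) ]) permutations
      ≡⟨ sumOver-cong permutations (λ w → cong [_] (sorted w)) ⟩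
    sumOver (λ w → [ increasing (permute (reverse w) t) ]) permutations ∎
    where
    open ≡-Reasoning
    order : Fin 4 → Fin 4 → Bool
    order i j = ltFin (entry t i) (entry t j)
    L : Fin 4 → Fin 4 → Bool
    L = relationFromBits (bitsOf order)
    L≈ : ∀ i j → order i j ≡ L i j
    L≈ = relationFromBits-bitsOf order (λ i → <ᵇ-false (toℕ (entry t i)) (toℕ (entry t i)) ℕP.≤-refl)
    L-strict : isStrictOrder L ≡ true
    L-strict = trans (sym (isStrictOrder-cong L≈)) (allFinB-intro _ λ i → allFinB-intro _ λ j → allFinB-intro _ λ k →
                 strict-<ᵇ (toℕ (entry t i)) (toℕ (entry t j)) (toℕ (entry t k)))
    sorted : ∀ w → increasingBy L (permute (reverse w) positions) ≡ increasing (permute (reverse w) t)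
    sorted w = begin
      increasingBy L (permute w⁻¹ positions)
        ≡⟨ increasingBy-cong L≈ (permute w⁻¹ positions) ⟨
      increasingBy order (permute w⁻¹ positions)
        ≡⟨ increasingBy-map ltFin (entry t) (permute w⁻¹ positions) ⟨
      increasing (mapTup (entry t) (permute w⁻¹ positions))
        ≡⟨ cong increasing (permute-map (entry t) w⁻¹ positions) ⟨
      increasing (permute w⁻¹ (mapTup (entry t) positions))
        ≡⟨ cong (λ s → increasing (permute w⁻¹ s)) (entry-positions t) ⟩
      increasing (permute w⁻¹ t) ∎
      where w⁻¹ = reverse w

  -- Symmetrisation: counting the tuples with a property that forces distinct
  -- entries amounts to counting, for each increasing tuple y, the permutations
  -- of y with the property.
  symmetrise : ∀ {n} (P : Tup (Fin n) → Bool) → (∀ t → P t ≡ true → distinct t ≡ true) →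
    ℕΣ⁴.Σ⁴ (λ t → [ P t ])
      ≡ ℕΣ⁴.Σ⁴ (λ y → [ increasing y ] ℕ.* sumOver (λ w → [ P (permute w y) ]) permutations)
  symmetrise {n} P P⇒distinct = begin
    Σ⁴ (λ t → [ P t ])
      ≡⟨ Σ⁴-cong (λ t → restrict t (P t) refl) ⟩
    Σ⁴ (λ t → [ distinct t ] ℕ.* [ P t ])
      ≡⟨ Σ⁴-cong (λ t → trans (cong (ℕ._* [ P t ]) (partition t)) (sumOver-*ʳ (sorts t) permutations [ P t ])) ⟩
    Σ⁴ (λ t → sumOver (λ w → sorts t w ℕ.* [ P t ]) permutations)
      ≡⟨ Σ⁴-sumOver permutations (λ w t → sorts t w ℕ.* [ P t ]) ⟩
    sumOver (λ w → Σ⁴ (λ t → sorts t w ℕ.* [ P t ])) permutations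
      ≡⟨ sumOver-cong permutations relabel ⟩
    sumOver (λ w → Σ⁴ (λ y → [ increasing y ] ℕ.* [ P (permute w y) ])) permutations
      ≡⟨ Σ⁴-sumOver permutations (λ w y → [ increasing y ] ℕ.* [ P (permute w y) ]) ⟨
    Σ⁴ (λ y → sumOver (λ w → [ increasing y ] ℕ.* [ P (permute w y) ]) permutations)
      ≡⟨ Σ⁴-cong (λ y → sumOver-*ˡ [ increasing y ] (λ w → [ P (permute w y) ]) permutations) ⟨
    Σ⁴ (λ y → [ increasing y ] ℕ.* sumOver (λ w → [ P (permute w y) ]) permutations) ∎
    where
    open ≡-Reasoning
    open ℕΣ⁴ using (Σ⁴; Σ⁴-cong)
    sorts : Tup (Fin n) → List Transposition → ℕ
    sorts t w = [ increasing (permute (reverse w) t) ]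
    restrict : ∀ t b → P t ≡ b → [ b ] ≡ [ distinct t ] ℕ.* [ b ]
    restrict t true  Pt rewrite P⇒distinct t Pt = refl
    restrict t false Pt = sym (ℕP.*-zeroʳ [ distinct t ])
    -- substitute y = permute (reverse w) t, which ranges over all tuples
    relabel : ∀ w → Σ⁴ (λ t → sorts t w ℕ.* [ P t ]) ≡ Σ⁴ (λ y → [ increasing y ] ℕ.* [ P (permute w y) ])
    relabel w = trans (Σ⁴-cong λ t → cong (λ s → sorts t w ℕ.* [ P s ]) (sym (permute-reverse w t)))
                      (sym (Σ⁴-permute (reverse w) λ y → [ increasing y ] ℕ.* [ P (permute w y) ]))

open SortingTuples

module Relabelling where

  open import Data.Bool using (Bool; _∧_; not)
  open import Data.Fin using (Fin)
  open import Data.Vec using ([]; _∷_; lookup)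
  import Data.Vec.Properties as VecP
  open import Data.Product using (_,_)
  open import Relation.Binary.PropositionalEquality hiding ([_])

  motifWalk : ∀ {n} (G : Graph n) → Motif → Tup (Fin n) → Bool
  motifWalk G m t = walk G t ∧ isMotif G m (outcome G t)

  claw : ∀ {n} (G : Graph n) → Tup (Fin n) → Bool
  claw G (v , x , y , z) = adj G v x ∧ (extends G v x y ∧ (extends G v x z ∧ not (eqFin z y)))

  pullback : ∀ {k n} → Graph n → (Fin k → Fin n) → Graph k
  pullback G f = record
    { adj    = λ i j → adj G (f i) (f j)
    ; sym    = λ i j → adj-sym G (f i) (f j)
    ; irrefl = λ i → adj-irrefl G (f i)
    }

  inducedIso-cong : ∀ {k} (G H : Graph k) → (∀ i j → adj G i j ≡ adj H i j) →
                    ∀ s m → inducedIso G s m ≡ inducedIso H s m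
  inducedIso-cong G H G≗H s m = anyFin-cong λ a → anyFin-cong λ b → anyFin-cong λ c → anyFin-cong λ d →
    cong (distinct4 a b c d ∧_) (allFinB-cong λ x → allFinB-cong λ y →
      cong (λ z → eqBool z (motifAdj m x y))
           (G≗H (lookup s (lookup (a ∷ b ∷ c ∷ d ∷ []) x)) (lookup s (lookup (a ∷ b ∷ c ∷ d ∷ []) y))))

  inducedIso-pullback : ∀ {k n} (G : Graph n) (f : Fin k → Fin n) a b c d m →
    inducedIso G (f a ∷ f b ∷ f c ∷ f d ∷ []) m ≡ inducedIso (pullback G f) (a ∷ b ∷ c ∷ d ∷ []) m
  inducedIso-pullback G f a b c d m = anyFin-cong λ a' → anyFin-cong λ b' → anyFin-cong λ c' → anyFin-cong λ d' →
    cong (distinct4 a' b' c' d' ∧_) (allFinB-cong λ x → allFinB-cong λ y →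
      cong (λ z → eqBool z (motifAdj m x y))
           (cong₂ (adj G) (VecP.lookup-map (lookup (a' ∷ b' ∷ c' ∷ d' ∷ []) x) f (a ∷ b ∷ c ∷ d ∷ []))
                          (VecP.lookup-map (lookup (a' ∷ b' ∷ c' ∷ d' ∷ []) y) f (a ∷ b ∷ c ∷ d ∷ []))))

  Monotone : ∀ {k n} → (Fin k → Fin n) → Set
  Monotone f = ∀ i j → ltFin (f i) (f j) ≡ ltFin i j

  monotone⇒eqFin : ∀ {k n} {f : Fin k → Fin n} → Monotone f → ∀ i j → eqFin (f i) (f j) ≡ eqFin i j
  monotone⇒eqFin {f = f} mono i j = begin
    eqFin (f i) (f j)                    ≡⟨ eqFin-incomparable (f i) (f j) ⟩
    incomparable ltFin (f i) (f j)       ≡⟨ cong₂ (λ p q → not p ∧ not q) (mono i j) (mono j i) ⟩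
    incomparable ltFin i j               ≡⟨ eqFin-incomparable i j ⟨
    eqFin i j                            ∎
    where open ≡-Reasoning

  module _ {k n} (G : Graph n) {f : Fin k → Fin n} (mono : Monotone f) where

    isEdge-pullback : ∀ u v → isEdge G (f u) (f v) ≡ isEdge (pullback G f) u v
    isEdge-pullback u v = cong (_∧ adj G (f u) (f v)) (mono u v)

    extends-pullback : ∀ u v x → extends G (f u) (f v) (f x) ≡ extends (pullback G f) u v x
    extends-pullback u v x = cong (λ b → adj G (f u) (f x) ∧ not b) (monotone⇒eqFin mono x v)

    motifWalk-pullback : ∀ m t → motifWalk G m (mapTup f t) ≡ motifWalk (pullback G f) m t
    motifWalk-pullback m (u , v , u' , v') =
      cong₂ _∧_ (cong₂ _∧_ (isEdge-pullback u v) (cong₂ _∧_ (extends-pullback u v u') (extends-pullback v u v')))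
                (cong₂ _∧_ (distinctBy-cong {e = λ i j → eqFin (f i) (f j)} (monotone⇒eqFin mono) (u' , u , v , v'))
                           (inducedIso-pullback G f u' u v v' m))

    claw-pullback : ∀ t → claw G (mapTup f t) ≡ claw (pullback G f) t
    claw-pullback (v , x , y , z) =
      cong (adj G (f v) (f x) ∧_) (cong₂ _∧_ (extends-pullback v x y)
        (cong₂ _∧_ (extends-pullback v x z) (cong not (monotone⇒eqFin mono z y))))

open Relabelling

module FourVertexGraphs where

  open import Data.Nat using (ℕ; _+_; _*_; _≡ᵇ_)
  open import Data.Bool using (Bool; true; false; _∧_; not)
  open import Data.Fin using (Fin)
  open import Data.Fin.Patterns using (0F; 1F; 2F; 3F)
  open import Data.Vec using (Vec; []; _∷_)
  open import Data.Product using (_,_)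
  open import Relation.Binary.PropositionalEquality hiding ([_])

  -- The graph on Fin 4 with edge set given by six bits (for 01, 02, 03, 12, 13, 23).
  patternAdj : Vec Bool 6 → Fin 4 → Fin 4 → Bool
  patternAdj e = relationFromBits (symmetricBits e)
    where
    symmetricBits : Vec Bool 6 → Vec Bool 12
    symmetricBits (e01 ∷ e02 ∷ e03 ∷ e12 ∷ e13 ∷ e23 ∷ []) =
      e01 ∷ e02 ∷ e03 ∷ e01 ∷ e12 ∷ e13 ∷ e02 ∷ e12 ∷ e23 ∷ e03 ∷ e13 ∷ e23 ∷ []

  patternGraph : Vec Bool 6 → Graph 4
  patternGraph e = record { adj = patternAdj e ; sym = symmetric e ; irrefl = irreflexive e }
    where
    symmetric : ∀ e i j → patternAdj e i j ≡ patternAdj e j i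
    symmetric (_ ∷ _ ∷ _ ∷ _ ∷ _ ∷ _ ∷ []) 0F 0F = refl
    symmetric (_ ∷ _ ∷ _ ∷ _ ∷ _ ∷ _ ∷ []) 0F 1F = refl
    symmetric (_ ∷ _ ∷ _ ∷ _ ∷ _ ∷ _ ∷ []) 0F 2F = refl
    symmetric (_ ∷ _ ∷ _ ∷ _ ∷ _ ∷ _ ∷ []) 0F 3F = refl
    symmetric (_ ∷ _ ∷ _ ∷ _ ∷ _ ∷ _ ∷ []) 1F 0F = refl
    symmetric (_ ∷ _ ∷ _ ∷ _ ∷ _ ∷ _ ∷ []) 1F 1F = refl
    symmetric (_ ∷ _ ∷ _ ∷ _ ∷ _ ∷ _ ∷ []) 1F 2F = refl
    symmetric (_ ∷ _ ∷ _ ∷ _ ∷ _ ∷ _ ∷ []) 1F 3F = refl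
    symmetric (_ ∷ _ ∷ _ ∷ _ ∷ _ ∷ _ ∷ []) 2F 0F = refl
    symmetric (_ ∷ _ ∷ _ ∷ _ ∷ _ ∷ _ ∷ []) 2F 1F = refl
    symmetric (_ ∷ _ ∷ _ ∷ _ ∷ _ ∷ _ ∷ []) 2F 2F = refl
    symmetric (_ ∷ _ ∷ _ ∷ _ ∷ _ ∷ _ ∷ []) 2F 3F = refl
    symmetric (_ ∷ _ ∷ _ ∷ _ ∷ _ ∷ _ ∷ []) 3F 0F = refl
    symmetric (_ ∷ _ ∷ _ ∷ _ ∷ _ ∷ _ ∷ []) 3F 1F = refl
    symmetric (_ ∷ _ ∷ _ ∷ _ ∷ _ ∷ _ ∷ []) 3F 2F = refl
    symmetric (_ ∷ _ ∷ _ ∷ _ ∷ _ ∷ _ ∷ []) 3F 3F = refl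
    irreflexive : ∀ e i → patternAdj e i i ≡ false
    irreflexive (_ ∷ _ ∷ _ ∷ _ ∷ _ ∷ _ ∷ []) 0F = refl
    irreflexive (_ ∷ _ ∷ _ ∷ _ ∷ _ ∷ _ ∷ []) 1F = refl
    irreflexive (_ ∷ _ ∷ _ ∷ _ ∷ _ ∷ _ ∷ []) 2F = refl
    irreflexive (_ ∷ _ ∷ _ ∷ _ ∷ _ ∷ _ ∷ []) 3F = refl

  edgesOf : Graph 4 → Vec Bool 6
  edgesOf H = adj H f0 f1 ∷ adj H f0 f2 ∷ adj H f0 f3 ∷ adj H f1 f2 ∷ adj H f1 f3 ∷ adj H f2 f3 ∷ []

  edgesOf-correct : ∀ H i j → adj H i j ≡ patternAdj (edgesOf H) i j
  edgesOf-correct H 0F 0F = adj-irrefl H f0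
  edgesOf-correct H 0F 1F = refl
  edgesOf-correct H 0F 2F = refl
  edgesOf-correct H 0F 3F = refl
  edgesOf-correct H 1F 0F = adj-sym H f1 f0
  edgesOf-correct H 1F 1F = adj-irrefl H f1
  edgesOf-correct H 1F 2F = refl
  edgesOf-correct H 1F 3F = refl
  edgesOf-correct H 2F 0F = adj-sym H f2 f0
  edgesOf-correct H 2F 1F = adj-sym H f2 f1
  edgesOf-correct H 2F 2F = adj-irrefl H f2
  edgesOf-correct H 2F 3F = refl
  edgesOf-correct H 3F 0F = adj-sym H f3 f0
  edgesOf-correct H 3F 1F = adj-sym H f3 f1
  edgesOf-correct H 3F 2F = adj-sym H f3 f2
  edgesOf-correct H 3F 3F = adj-irrefl H f3

  module _ {k} (G H : Graph k) (G≗H : ∀ i j → adj G i j ≡ adj H i j) where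

    extends-cong : ∀ u v x → extends G u v x ≡ extends H u v x
    extends-cong u v x = cong (_∧ not (eqFin x v)) (G≗H u x)

    motifWalk-cong : ∀ m t → motifWalk G m t ≡ motifWalk H m t
    motifWalk-cong m (u , v , u' , v') =
      cong₂ _∧_ (cong₂ _∧_ (cong (ltFin u v ∧_) (G≗H u v)) (cong₂ _∧_ (extends-cong u v u') (extends-cong v u v')))
                (cong (distinct4 u' u v v' ∧_) (inducedIso-cong G H G≗H (u' ∷ u ∷ v ∷ v' ∷ []) m))

    claw-cong : ∀ t → claw G t ≡ claw H t
    claw-cong (v , x , y , z) =
      cong₂ _∧_ (G≗H v x) (cong₂ _∧_ (extends-cong v x y) (cong (_∧ not (eqFin z y)) (extends-cong v x z)))

  vertices : Vec (Fin 4) 4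
  vertices = f0 ∷ f1 ∷ f2 ∷ f3 ∷ []

  pathCount : Graph 4 → Motif → ℕ
  pathCount H m = sumOver (λ w → [ motifWalk H m (permute w positions) ]) permutations

  clawCount : Graph 4 → ℕ
  clawCount H = sumOver (λ w → [ claw H (permute w positions) ]) permutations

  -- Number of 3-stars in the motif induced by H (1, 1, 2 and 4 in motifs 1, 3, 5, 6).
  starsInMotif : Graph 4 → ℕ
  starsInMotif H = [ inducedIso H vertices star3 ] + [ inducedIso H vertices tailedTriangle ]
                 + 2 * [ inducedIso H vertices chordalCycle4 ] + 4 * [ inducedIso H vertices clique4 ]

  pathProperty : Motif → Vec Bool 6 → Bool
  pathProperty m e = pathCount (patternGraph e) m ≡ᵇ A₂ m * [ inducedIso (patternGraph e) vertices m ]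

  clawProperty : Vec Bool 6 → Bool
  clawProperty e = clawCount (patternGraph e) ≡ᵇ 6 * starsInMotif (patternGraph e)

  -- Checked by evaluation on all 64 graphs on Fin 4: a graph isomorphic to
  -- motif i contains A_{2,i} three-paths, and its ordered 3-stars are counted by starsInMotif.
  path-check : ∀ m → allBits 6 (pathProperty m) ≡ true
  path-check star3          = refl
  path-check path3          = refl
  path-check tailedTriangle = refl
  path-check cycle4         = refl
  path-check chordalCycle4  = refl
  path-check clique4        = refl

  claw-check : allBits 6 clawProperty ≡ true
  claw-check = refl

  paths-in-motif : ∀ H m → pathCount H m ≡ A₂ m * [ inducedIso H vertices m ]
  paths-in-motif H m = begin
    pathCount H m
      ≡⟨ sumOver-cong permutations (λ w → cong [_] (motifWalk-cong H P (edgesOf-correct H) m (permute w positions))) ⟩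
    pathCount P m
      ≡⟨ ≡ᵇ-sound _ _ (allBits-sound 6 (pathProperty m) (path-check m) (edgesOf H)) ⟩
    A₂ m * [ inducedIso P vertices m ]
      ≡⟨ cong (λ b → A₂ m * [ b ]) (inducedIso-cong H P (edgesOf-correct H) vertices m) ⟨
    A₂ m * [ inducedIso H vertices m ] ∎
    where
    open ≡-Reasoning
    P : Graph 4
    P = patternGraph (edgesOf H)

  stars-in-motif : ∀ H → clawCount H ≡ 6 * starsInMotif H
  stars-in-motif H = begin
    clawCount H
      ≡⟨ sumOver-cong permutations (λ w → cong [_] (claw-cong H P (edgesOf-correct H) (permute w positions))) ⟩
    clawCount P
      ≡⟨ ≡ᵇ-sound _ _ (allBits-sound 6 clawProperty claw-check (edgesOf H)) ⟩
    6 * starsInMotif P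
      ≡⟨ cong (6 *_) (cong₂ _+_ (cong₂ _+_ (cong₂ _+_ (iso star3) (iso tailedTriangle))
                                            (cong (2 *_) (iso chordalCycle4))) (cong (4 *_) (iso clique4))) ⟨
    6 * starsInMotif H ∎
    where
    open ≡-Reasoning
    P : Graph 4
    P = patternGraph (edgesOf H)
    iso : ∀ m → [ inducedIso H vertices m ] ≡ [ inducedIso P vertices m ]
    iso m = cong [_] (inducedIso-cong H P (edgesOf-correct H) vertices m)

open FourVertexGraphs

module MotifCounts where

  open import Data.Nat using (ℕ; zero; suc; _+_; _*_; _∸_; _/_; _<_; s≤s)
  import Data.Nat.Properties as ℕP
  open import Data.Nat.DivMod using (m*n/n≡m)
  open import Data.Bool using (Bool; true; false; _∧_; not)
  import Data.Bool.Properties as BoolP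
  open import Data.Fin as Fin using (Fin; toℕ)
  open import Data.Fin.Patterns using (0F; 1F; 2F; 3F)
  import Data.Fin.Properties as FinP
  open import Data.Vec using (Vec; []; _∷_)
  open import Data.Product using (_,_)
  open import Data.Empty using (⊥; ⊥-elim)
  import Algebra.Solver.CommutativeMonoid BoolP.∧-commutativeMonoid as ∧-Solver
  open import Algebra.Properties.CommutativeSemigroup ℕP.*-commutativeSemigroup using (x∙yz≈y∙xz)
  open import Data.Nat.Solver using (module +-*-Solver)
  open +-*-Solver
  open import Relation.Nullary using (yes; no)
  open import Relation.Binary.Definitions using (tri<; tri≈; tri>)
  open import Relation.Binary.PropositionalEquality hiding ([_])

  increasing⇒< : ∀ {n} (y : Tup (Fin n)) → increasing y ≡ true →
                 ∀ i j → toℕ i < toℕ j → toℕ (entry y i) < toℕ (entry y j)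
  increasing⇒< (a , b , c , d) inc = ordered
    where
    ab : toℕ a < toℕ b
    ab = <ᵇ-sound _ _ (∧-elimˡ inc)
    bc : toℕ b < toℕ c
    bc = <ᵇ-sound _ _ (∧-elimˡ (∧-elimʳ {ltFin a b} inc))
    cd : toℕ c < toℕ d
    cd = <ᵇ-sound _ _ (∧-elimʳ (∧-elimʳ {ltFin a b} inc))
    ordered : ∀ i j → toℕ i < toℕ j → toℕ (entry (a , b , c , d) i) < toℕ (entry (a , b , c , d) j)
    ordered 0F 1F _ = ab
    ordered 0F 2F _ = ℕP.<-trans ab bc
    ordered 0F 3F _ = ℕP.<-trans ab (ℕP.<-trans bc cd)
    ordered 1F 2F _ = bc
    ordered 1F 3F _ = ℕP.<-trans bc cd
    ordered 2F 3F _ = cd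
    ordered 1F 1F (s≤s ())
    ordered (Fin.suc (Fin.suc i)) 1F (s≤s ())
    ordered (Fin.suc (Fin.suc i)) 2F (s≤s (s≤s ()))
    ordered (Fin.suc (Fin.suc (Fin.suc i))) 3F (s≤s (s≤s (s≤s ())))

  increasing⇒monotone : ∀ {n} (y : Tup (Fin n)) → increasing y ≡ true → Monotone (entry y)
  increasing⇒monotone y inc i j with ℕP.<-cmp (toℕ i) (toℕ j)
  ... | tri< i<j _ _ = trans (<ᵇ-complete (increasing⇒< y inc i j i<j)) (sym (<ᵇ-complete i<j))
  ... | tri≈ _ i≡j _ rewrite FinP.toℕ-injective i≡j =
    trans (<ᵇ-false (toℕ (entry y j)) _ ℕP.≤-refl) (sym (<ᵇ-false (toℕ j) _ ℕP.≤-refl))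
  ... | tri> _ _ j<i =
    trans (<ᵇ-false _ _ (ℕP.<⇒≤ (increasing⇒< y inc j i j<i))) (sym (<ᵇ-false _ _ (ℕP.<⇒≤ j<i)))

  tupleVec : ∀ {A : Set} → Tup A → Vec A 4
  tupleVec (a , b , c , d) = a ∷ b ∷ c ∷ d ∷ []

  eqFin-sym : ∀ {n} (a b : Fin n) → eqFin a b ≡ eqFin b a
  eqFin-sym a b with a Fin.≟ b | b Fin.≟ a
  ... | yes _   | yes _   = refl
  ... | no  _   | no  _   = refl
  ... | yes a≡b | no  b≢a = ⊥-elim (b≢a (sym a≡b))
  ... | no  a≢b | yes b≡a = ⊥-elim (a≢b (sym b≡a))

  distinct4-rotate : ∀ {n} (a b c d : Fin n) → distinct4 c a b d ≡ distinct4 a b c d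
  distinct4-rotate a b c d = begin
    distinct4 c a b d
      ≡⟨ cong₂ (λ p q → not p ∧ not q ∧ not (eqFin c d) ∧ not (eqFin a b) ∧ not (eqFin a d) ∧ not (eqFin b d))
               (eqFin-sym c a) (eqFin-sym c b) ⟩
    not (eqFin a c) ∧ not (eqFin b c) ∧ not (eqFin c d) ∧ not (eqFin a b) ∧ not (eqFin a d) ∧ not (eqFin b d)
      ≡⟨ shuffle (not (eqFin a b)) (not (eqFin a c)) (not (eqFin a d)) (not (eqFin b c)) (not (eqFin b d)) (not (eqFin c d)) ⟩
    distinct4 a b c d ∎
    where
    open ≡-Reasoning
    shuffle : ∀ x₁ x₂ x₃ x₄ x₅ x₆ →
              (x₂ ∧ x₄ ∧ x₆ ∧ x₁ ∧ x₃ ∧ x₅) ≡ (x₁ ∧ x₂ ∧ x₃ ∧ x₄ ∧ x₅ ∧ x₆)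
    shuffle = ∧-Solver.solve 6 (λ x₁ x₂ x₃ x₄ x₅ x₆ → x₂ ⊕ (x₄ ⊕ (x₆ ⊕ (x₁ ⊕ (x₃ ⊕ x₅))))
                                                  ⊜ x₁ ⊕ (x₂ ⊕ (x₃ ⊕ (x₄ ⊕ (x₅ ⊕ x₆))))) refl
      where open ∧-Solver using (_⊕_; _⊜_)

  -- Binomial coefficients d choose 2 and d choose 3 by Pascal's rule; they
  -- show that 6 divides d(d-1)(d-2), so that N₁ is exact.
  choose2′ : ℕ → ℕ
  choose2′ zero    = 0
  choose2′ (suc d) = d + choose2′ d

  choose3′ : ℕ → ℕ
  choose3′ zero    = 0
  choose3′ (suc d) = choose2′ d + choose3′ d

  choose2′-formula : ∀ d → d * (d ∸ 1) ≡ choose2′ d * 2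
  choose2′-formula zero          = refl
  choose2′-formula (suc zero)    = refl
  choose2′-formula (suc (suc e)) = begin
    (2 + e) * (1 + e)
      ≡⟨ solve 1 (λ e → (con 2 :+ e) :* (con 1 :+ e) := (con 1 :+ e) :* con 2 :+ (con 1 :+ e) :* e) refl e ⟩
    (1 + e) * 2 + (1 + e) * e
      ≡⟨ cong ((1 + e) * 2 +_) (choose2′-formula (suc e)) ⟩
    (1 + e) * 2 + choose2′ (1 + e) * 2
      ≡⟨ ℕP.*-distribʳ-+ 2 (1 + e) (choose2′ (1 + e)) ⟨
    choose2′ (2 + e) * 2 ∎
    where open ≡-Reasoning

  choose3′-formula : ∀ d → d * (d ∸ 1) * (d ∸ 2) ≡ choose3′ d * 6
  choose3′-formula zero                = refl
  choose3′-formula (suc zero)          = refl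
  choose3′-formula (suc (suc zero))    = refl
  choose3′-formula (suc (suc (suc f))) = begin
    (3 + f) * (2 + f) * (1 + f)
      ≡⟨ solve 1 (λ f → (con 3 :+ f) :* (con 2 :+ f) :* (con 1 :+ f)
                      := ((con 2 :+ f) :* (con 1 :+ f)) :* con 3 :+ (con 2 :+ f) :* (con 1 :+ f) :* f) refl f ⟩
    (2 + f) * (1 + f) * 3 + (2 + f) * (1 + f) * f
      ≡⟨ cong₂ (λ a b → a * 3 + b) (choose2′-formula (2 + f)) (choose3′-formula (suc (suc f))) ⟩
    choose2′ (2 + f) * 2 * 3 + choose3′ (2 + f) * 6
      ≡⟨ cong (_+ choose3′ (2 + f) * 6) (ℕP.*-assoc (choose2′ (2 + f)) 2 3) ⟩
    choose2′ (2 + f) * 6 + choose3′ (2 + f) * 6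
      ≡⟨ ℕP.*-distribʳ-+ 6 (choose2′ (2 + f)) (choose3′ (2 + f)) ⟨
    choose3′ (3 + f) * 6 ∎
    where open ≡-Reasoning

  six-choose3 : ∀ {n} (G : Graph n) d → 6 * choose3 G d ≡ d * (d ∸ 1) * (d ∸ 2)
  six-choose3 G d = begin
    6 * (d * (d ∸ 1) * (d ∸ 2) / 6)   ≡⟨ cong (λ x → 6 * (x / 6)) (choose3′-formula d) ⟩
    6 * (choose3′ d * 6 / 6)          ≡⟨ cong (6 *_) (m*n/n≡m (choose3′ d) 6) ⟩
    6 * choose3′ d                    ≡⟨ ℕP.*-comm 6 (choose3′ d) ⟩
    choose3′ d * 6                    ≡⟨ choose3′-formula d ⟨
    d * (d ∸ 1) * (d ∸ 2)             ∎
    where open ≡-Reasoning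

  module _ {n : ℕ} (G : Graph n) where

    motifWalk⇒distinct : ∀ m t → motifWalk G m t ≡ true → distinct t ≡ true
    motifWalk⇒distinct m (u , v , u' , v') mw =
      trans (sym (distinct4-rotate u v u' v')) (∧-elimˡ (∧-elimʳ {walk G (u , v , u' , v')} mw))

    adj⇒≢ : ∀ a b → adj G a b ≡ true → eqFin a b ≡ false
    adj⇒≢ a b ab with a Fin.≟ b
    ... | no  _    = refl
    ... | yes refl = ⊥-elim (false≢true (trans (sym (adj-irrefl G a)) ab))
      where
      false≢true : false ≡ true → ⊥
      false≢true ()

    claw⇒distinct : ∀ t → claw G t ≡ true → distinct t ≡ true
    claw⇒distinct (v , x , y , z) c
      with adj G v x in vx | adj G v y in vy | eqFin y x in yx | adj G v z in vz | eqFin z x in zx | eqFin z y in zy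
    ... | true | true | false | true | false | false
      rewrite adj⇒≢ v x vx | adj⇒≢ v y vy | adj⇒≢ v z vz
            | eqFin-sym x y | yx | eqFin-sym x z | zx | eqFin-sym y z | zy = refl

    orderings-pullback : (Q : ∀ {k} → Graph k → Tup (Fin k) → Bool) →
      (∀ {f : Fin 4 → Fin n} → Monotone f → ∀ t → Q G (mapTup f t) ≡ Q (pullback G f) t) →
      ∀ y → increasing y ≡ true →
      sumOver (λ w → [ Q G (permute w y) ]) permutations
        ≡ sumOver (λ w → [ Q (pullback G (entry y)) (permute w positions) ]) permutations
    orderings-pullback Q Q-pullback y inc = sumOver-cong permutations λ w → cong [_] (begin
      Q G (permute w y)                                    ≡⟨ cong (λ s → Q G (permute w s)) (entry-positions y) ⟨
      Q G (permute w (mapTup (entry y) positions))         ≡⟨ cong (Q G) (permute-map (entry y) w positions) ⟩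
      Q G (mapTup (entry y) (permute w positions))         ≡⟨ Q-pullback (increasing⇒monotone y inc) (permute w positions) ⟩
      Q (pullback G (entry y)) (permute w positions)       ∎)
      where open ≡-Reasoning

    motifIndicator : Motif → Tup (Fin n) → ℕ
    motifIndicator m y = [ inducedIso G (tupleVec y) m ]

    paths-through-sorted : ∀ m y → increasing y ≡ true →
      sumOver (λ w → [ motifWalk G m (permute w y) ]) permutations ≡ A₂ m * motifIndicator m y
    paths-through-sorted m y@(a , b , c , d) inc = begin
      sumOver (λ w → [ motifWalk G m (permute w y) ]) permutations
        ≡⟨ orderings-pullback (λ H → motifWalk H m) (λ mono → motifWalk-pullback G mono m) y inc ⟩
      pathCount (pullback G (entry y)) m
        ≡⟨ paths-in-motif (pullback G (entry y)) m ⟩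
      A₂ m * [ inducedIso (pullback G (entry y)) vertices m ]
        ≡⟨ cong (λ i → A₂ m * [ i ]) (inducedIso-pullback G (entry y) f0 f1 f2 f3 m) ⟨
      A₂ m * motifIndicator m y ∎
      where open ≡-Reasoning

    starIndicator : Tup (Fin n) → ℕ
    starIndicator y = motifIndicator star3 y + motifIndicator tailedTriangle y
                    + 2 * motifIndicator chordalCycle4 y + 4 * motifIndicator clique4 y

    stars-through-sorted : ∀ y → increasing y ≡ true →
      sumOver (λ w → [ claw G (permute w y) ]) permutations ≡ 6 * starIndicator y
    stars-through-sorted y@(a , b , c , d) inc = begin
      sumOver (λ w → [ claw G (permute w y) ]) permutations
        ≡⟨ orderings-pullback claw (λ mono → claw-pullback G mono) y inc ⟩
      clawCount (pullback G (entry y))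
        ≡⟨ stars-in-motif (pullback G (entry y)) ⟩
      6 * starsInMotif (pullback G (entry y))
        ≡⟨ cong (6 *_) (cong₂ _+_ (cong₂ _+_ (cong₂ _+_ (iso star3) (iso tailedTriangle))
                                  (cong (2 *_) (iso chordalCycle4))) (cong (4 *_) (iso clique4))) ⟨
      6 * starIndicator y ∎
      where
      open ≡-Reasoning
      iso : ∀ m → motifIndicator m y ≡ [ inducedIso (pullback G (entry y)) vertices m ]
      iso m = cong [_] (inducedIso-pullback G (entry y) f0 f1 f2 f3 m)

    sortedMotifs : Motif → ℕ
    sortedMotifs m = ℕΣ⁴.Σ⁴ λ y → [ increasing y ] * motifIndicator m y

    C≡sortedMotifs : ∀ m → C G m ≡ sortedMotifs m
    C≡sortedMotifs m =
      trans (sumFinℕ≡Σ λ a → sumFinℕ λ b → sumFinℕ λ c → countFin λ d → test a b c d) (ℕΣ.sum-cong-≗ λ a →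
      trans (sumFinℕ≡Σ λ b → sumFinℕ λ c → countFin λ d → test a b c d)             (ℕΣ.sum-cong-≗ λ b →
      trans (sumFinℕ≡Σ λ c → countFin λ d → test a b c d)                           (ℕΣ.sum-cong-≗ λ c →
      trans (countFin≡Σ λ d → test a b c d)                                          (ℕΣ.sum-cong-≗ λ d →
      split (ltFin a b) (ltFin b c) (ltFin c d) (inducedIso G (a ∷ b ∷ c ∷ d ∷ []) m)))))
      where
      test : Fin n → Fin n → Fin n → Fin n → Bool
      test a b c d = ltFin a b ∧ ltFin b c ∧ ltFin c d ∧ inducedIso G (a ∷ b ∷ c ∷ d ∷ []) m
      split : ∀ p q r s → [ p ∧ q ∧ r ∧ s ] ≡ [ p ∧ q ∧ r ] * [ s ]
      split p q r s = trans (cong [_] (trans (cong (p ∧_) (sym (BoolP.∧-assoc q r s))) (sym (BoolP.∧-assoc p (q ∧ r) s))))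
                            ([∧]≡[]*[] (p ∧ q ∧ r) s)

    motifWalks : Motif → ℕ
    motifWalks m = ℕΣ⁴.Σ⁴ λ t → [ motifWalk G m t ]

    motifWalks≡ : ∀ m → motifWalks m ≡ A₂ m * C G m
    motifWalks≡ m = begin
      motifWalks m
        ≡⟨ symmetrise (motifWalk G m) (motifWalk⇒distinct m) ⟩
      Σ⁴ (λ y → [ increasing y ] * sumOver (λ w → [ motifWalk G m (permute w y) ]) permutations)
        ≡⟨ Σ⁴-cong (λ y → restrict-eq (increasing y) _ _ (paths-through-sorted m y)) ⟩
      Σ⁴ (λ y → [ increasing y ] * (A₂ m * motifIndicator m y))
        ≡⟨ Σ⁴-cong (λ y → x∙yz≈y∙xz [ increasing y ] (A₂ m) (motifIndicator m y)) ⟩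
      Σ⁴ (λ y → A₂ m * ([ increasing y ] * motifIndicator m y))
        ≡⟨ Σ⁴-*ˡ (A₂ m) (λ y → [ increasing y ] * motifIndicator m y) ⟩
      A₂ m * sortedMotifs m
        ≡⟨ cong (A₂ m *_) (C≡sortedMotifs m) ⟨
      A₂ m * C G m ∎
      where
      open ≡-Reasoning
      open ℕΣ⁴ using (Σ⁴; Σ⁴-cong; Σ⁴-*ˡ)

    sortedStars : ℕΣ⁴.Σ⁴ (λ y → [ increasing y ] * starIndicator y)
                  ≡ C G star3 + C G tailedTriangle + 2 * C G chordalCycle4 + 4 * C G clique4
    sortedStars = begin
      Σ⁴ (λ y → [ increasing y ] * starIndicator y)
        ≡⟨ Σ⁴-cong (λ y → distribute [ increasing y ] (motifIndicator star3 y) (motifIndicator tailedTriangle y)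
                                     (motifIndicator chordalCycle4 y) (motifIndicator clique4 y)) ⟩
      Σ⁴ (λ y → S star3 y + S tailedTriangle y + 2 * S chordalCycle4 y + 4 * S clique4 y)
        ≡⟨ Σ⁴-+ (λ y → S star3 y + S tailedTriangle y + 2 * S chordalCycle4 y) (λ y → 4 * S clique4 y) ⟩
      Σ⁴ (λ y → S star3 y + S tailedTriangle y + 2 * S chordalCycle4 y) + Σ⁴ (λ y → 4 * S clique4 y)
        ≡⟨ cong₂ _+_ (Σ⁴-+ (λ y → S star3 y + S tailedTriangle y) (λ y → 2 * S chordalCycle4 y))
                     (Σ⁴-*ˡ 4 (S clique4)) ⟩
      Σ⁴ (λ y → S star3 y + S tailedTriangle y) + Σ⁴ (λ y → 2 * S chordalCycle4 y) + 4 * sortedMotifs clique4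
        ≡⟨ cong₂ (λ p q → p + q + 4 * sortedMotifs clique4) (Σ⁴-+ (S star3) (S tailedTriangle))
                                                            (Σ⁴-*ˡ 2 (S chordalCycle4)) ⟩
      sortedMotifs star3 + sortedMotifs tailedTriangle + 2 * sortedMotifs chordalCycle4 + 4 * sortedMotifs clique4
        ≡⟨ cong₂ _+_ (cong₂ _+_ (cong₂ _+_ (C≡sortedMotifs star3) (C≡sortedMotifs tailedTriangle))
                                (cong (2 *_) (C≡sortedMotifs chordalCycle4)))
                     (cong (4 *_) (C≡sortedMotifs clique4)) ⟨
      C G star3 + C G tailedTriangle + 2 * C G chordalCycle4 + 4 * C G clique4 ∎
      where
      open ≡-Reasoning
      open ℕΣ⁴ using (Σ⁴; Σ⁴-cong; Σ⁴-+; Σ⁴-*ˡ)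
      S : Motif → Tup (Fin n) → ℕ
      S m y = [ increasing y ] * motifIndicator m y
      distribute : ∀ x a b c d → x * (a + b + 2 * c + 4 * d) ≡ x * a + x * b + 2 * (x * c) + 4 * (x * d)
      distribute = solve 5 (λ x a b c d → x :* (a :+ b :+ con 2 :* c :+ con 4 :* d)
                                        := x :* a :+ x :* b :+ con 2 :* (x :* c) :+ con 4 :* (x :* d)) refl

    -- Each copy of motifs 1, 3, 5, 6 contains 1, 1, 2, 4 three-stars, each
    -- ordered in 6 ways.
    claws≡ : ℕΣ⁴.Σ⁴ (λ t → [ claw G t ])
             ≡ 6 * (C G star3 + C G tailedTriangle + 2 * C G chordalCycle4 + 4 * C G clique4)
    claws≡ = begin
      Σ⁴ (λ t → [ claw G t ])
        ≡⟨ symmetrise (claw G) claw⇒distinct ⟩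
      Σ⁴ (λ y → [ increasing y ] * sumOver (λ w → [ claw G (permute w y) ]) permutations)
        ≡⟨ Σ⁴-cong (λ y → restrict-eq (increasing y) _ _ (stars-through-sorted y)) ⟩
      Σ⁴ (λ y → [ increasing y ] * (6 * starIndicator y))
        ≡⟨ Σ⁴-cong (λ y → x∙yz≈y∙xz [ increasing y ] 6 (starIndicator y)) ⟩
      Σ⁴ (λ y → 6 * ([ increasing y ] * starIndicator y))
        ≡⟨ Σ⁴-*ˡ 6 (λ y → [ increasing y ] * starIndicator y) ⟩
      6 * Σ⁴ (λ y → [ increasing y ] * starIndicator y)
        ≡⟨ cong (6 *_) sortedStars ⟩
      6 * (C G star3 + C G tailedTriangle + 2 * C G chordalCycle4 + 4 * C G clique4) ∎
      where
      open ≡-Reasoning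
      open ℕΣ⁴ using (Σ⁴; Σ⁴-cong; Σ⁴-*ˡ)

    claws-through : ∀ v x y → adj G v x ≡ true →
      Σℕ (λ z → [ extends G v x y ∧ (extends G v x z ∧ not (eqFin z y)) ]) ≡ [ extends G v x y ] * (deg G v ∸ 1 ∸ 1)
    claws-through v x y vx with extends G v x y in vxy
    ... | false = ℕΣ.sum-replicate-zero n
    ... | true  = begin
      Σℕ (λ z → [ extends G v x z ∧ not (eqFin z y) ])              ≡⟨ cong (_∸ 1) (count-suc (extends G v x) y vxy) ⟨
      Σℕ (λ z → [ extends G v x z ]) ∸ 1                             ≡⟨ cong (_∸ 1) (extends-count G v x vx) ⟩
      deg G v ∸ 1 ∸ 1                                                ≡⟨ ℕP.+-identityʳ _ ⟨
      1 * (deg G v ∸ 1 ∸ 1)                                          ∎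
      where open ≡-Reasoning

    claws-from : ∀ v x → (Σℕ λ y → Σℕ λ z → [ claw G (v , x , y , z) ]) ≡ [ adj G v x ] * ((deg G v ∸ 1) * (deg G v ∸ 1 ∸ 1))
    claws-from v x with adj G v x in vx
    ... | false = trans (ℕΣ.sum-cong-≗ {n} {x = λ _ → Σℕ {n} λ _ → 0} λ _ → ℕΣ.sum-replicate-zero n)
                        (ℕΣ.sum-replicate-zero n)
    ... | true  = begin
      (Σℕ λ y → Σℕ λ z → [ extends G v x y ∧ (extends G v x z ∧ not (eqFin z y)) ])
        ≡⟨ ℕΣ.sum-cong-≗ (λ y → claws-through v x y vx) ⟩
      Σℕ (λ y → [ extends G v x y ] * (deg G v ∸ 1 ∸ 1))
        ≡⟨ ℕΣ.*-distribʳ-sum (deg G v ∸ 1 ∸ 1) (λ y → [ extends G v x y ]) ⟨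
      Σℕ (λ y → [ extends G v x y ]) * (deg G v ∸ 1 ∸ 1)
        ≡⟨ cong (_* (deg G v ∸ 1 ∸ 1)) (extends-count G v x vx) ⟩
      (deg G v ∸ 1) * (deg G v ∸ 1 ∸ 1)
        ≡⟨ ℕP.+-identityʳ _ ⟨
      1 * ((deg G v ∸ 1) * (deg G v ∸ 1 ∸ 1)) ∎
      where open ≡-Reasoning

    claws-at : ∀ v → (Σℕ λ x → Σℕ λ y → Σℕ λ z → [ claw G (v , x , y , z) ]) ≡ deg G v * (deg G v ∸ 1) * (deg G v ∸ 2)
    claws-at v = begin
      (Σℕ λ x → Σℕ λ y → Σℕ λ z → [ claw G (v , x , y , z) ])
        ≡⟨ ℕΣ.sum-cong-≗ (claws-from v) ⟩
      Σℕ (λ x → [ adj G v x ] * M)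
        ≡⟨ ℕΣ.*-distribʳ-sum M (λ x → [ adj G v x ]) ⟨
      Σℕ (λ x → [ adj G v x ]) * M
        ≡⟨ cong (_* M) (countFin≡Σ (adj G v)) ⟨
      deg G v * M
        ≡⟨ ℕP.*-assoc (deg G v) _ _ ⟨
      deg G v * (deg G v ∸ 1) * (deg G v ∸ 1 ∸ 1)
        ≡⟨ cong (deg G v * (deg G v ∸ 1) *_) (ℕP.∸-+-assoc (deg G v) 1 1) ⟩
      deg G v * (deg G v ∸ 1) * (deg G v ∸ 2) ∎
      where
      open ≡-Reasoning
      M : ℕ
      M = (deg G v ∸ 1) * (deg G v ∸ 1 ∸ 1)

    six-N₁ : 6 * N₁ G ≡ ℕΣ⁴.Σ⁴ (λ t → [ claw G t ])
    six-N₁ = begin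
      6 * N₁ G                                        ≡⟨ cong (6 *_) (foldr-map≡Σ (λ v → choose3 G (deg G v))) ⟩
      6 * Σℕ (λ v → choose3 G (deg G v))               ≡⟨ ℕΣ.*-distribˡ-sum 6 (λ v → choose3 G (deg G v)) ⟩
      Σℕ (λ v → 6 * choose3 G (deg G v))               ≡⟨ ℕΣ.sum-cong-≗ (λ v → six-choose3 G (deg G v)) ⟩
      Σℕ (λ v → deg G v * (deg G v ∸ 1) * (deg G v ∸ 2)) ≡⟨ ℕΣ.sum-cong-≗ claws-at ⟨
      ℕΣ⁴.Σ⁴ (λ t → [ claw G t ])                     ∎
      where open ≡-Reasoning

    N₁≡ : N₁ G ≡ C G star3 + C G tailedTriangle + 2 * C G chordalCycle4 + 4 * C G clique4
    N₁≡ = ℕP.*-cancelˡ-≡ _ _ 6 (trans six-N₁ claws≡)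

open MotifCounts

module Unbiasedness where

  open import Data.Nat using (ℕ; _+_; _*_; _<_; _≥_; s≤s; z≤n)
  open import Data.Rational as ℚ using (ℚ)
  open import Data.Rational.Solver using (module +-*-Solver)
  open import Data.Vec using (Vec)
  open import Relation.Binary.PropositionalEquality hiding ([_])
  open +-*-Solver

  module _ {n : ℕ} (G : Graph n) (W>0 : 0 < W G) (k : ℕ) (k≥1 : k ≥ 1) where

    Ĉ₃ Ĉ₅ Ĉ₆ : Vec (Outcome G) k → ℚ
    Ĉ₃ = Ĉ' G tailedTriangle
    Ĉ₅ = Ĉ' G chordalCycle4
    Ĉ₆ = Ĉ' G clique4

    C₁ C₃ C₅ C₆ : ℚ
    C₁ = ℕtoℚ (C G star3)
    C₃ = ℕtoℚ (C G tailedTriangle)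
    C₅ = ℕtoℚ (C G chordalCycle4)
    C₆ = ℕtoℚ (C G clique4)

    -- For i ∈ {2,…,6}: p_i = A_{2,i} C_i / W, hence E[Ĉ_i] = C_i.
    Ĉ'-unbiased : ∀ m → 0 < A₂ m → Eₖ G k (Ĉ' G m) ≡ ℕtoℚ (C G m)
    Ĉ'-unbiased m A>0 = begin
      Eₖ G k (Ĉ' G m)
        ≡⟨ Eₖ-Ĉ' G W>0 k k≥1 m ⟩
      frac (W G) (A₂ m) ℚ.* motifProbability G m
        ≡⟨ cong (frac (W G) (A₂ m) ℚ.*_) (E₁-indicator G (isMotif G m)) ⟩
      frac (W G) (A₂ m) ℚ.* (frac 1 (W G) ℚ.* ℕtoℚ (motifWalks G m))
        ≡⟨ cong (λ t → frac (W G) (A₂ m) ℚ.* (frac 1 (W G) ℚ.* ℕtoℚ t)) (motifWalks≡ G m) ⟩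
      frac (W G) (A₂ m) ℚ.* (frac 1 (W G) ℚ.* ℕtoℚ (A₂ m * C G m))
        ≡⟨ cancel-fracs (C G m) W>0 A>0 ⟩
      ℕtoℚ (C G m) ∎
      where open ≡-Reasoning

    Ĉ₁-expectation : Eₖ G k (Ĉ G star3)
      ≡ ℕtoℚ (N₁ G) ℚ.- Eₖ G k Ĉ₃ ℚ.- ℕtoℚ 2 ℚ.* Eₖ G k Ĉ₅ ℚ.- ℕtoℚ 4 ℚ.* Eₖ G k Ĉ₆
    Ĉ₁-expectation = begin
      Eₖ G k (Ĉ G star3)
        ≡⟨ Eₖ-- G k (λ xs → N ℚ.- Ĉ₃ xs ℚ.- two ℚ.* Ĉ₅ xs) (λ xs → four ℚ.* Ĉ₆ xs) ⟩
      Eₖ G k (λ xs → N ℚ.- Ĉ₃ xs ℚ.- two ℚ.* Ĉ₅ xs) ℚ.- Eₖ G k (λ xs → four ℚ.* Ĉ₆ xs)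
        ≡⟨ cong₂ ℚ._-_ (Eₖ-- G k (λ xs → N ℚ.- Ĉ₃ xs) (λ xs → two ℚ.* Ĉ₅ xs)) (Eₖ-* G k four Ĉ₆) ⟩
      Eₖ G k (λ xs → N ℚ.- Ĉ₃ xs) ℚ.- Eₖ G k (λ xs → two ℚ.* Ĉ₅ xs) ℚ.- four ℚ.* Eₖ G k Ĉ₆
        ≡⟨ cong₂ (λ p q → p ℚ.- q ℚ.- four ℚ.* Eₖ G k Ĉ₆) (Eₖ-- G k (λ _ → N) Ĉ₃) (Eₖ-* G k two Ĉ₅) ⟩
      Eₖ G k (λ _ → N) ℚ.- Eₖ G k Ĉ₃ ℚ.- two ℚ.* Eₖ G k Ĉ₅ ℚ.- four ℚ.* Eₖ G k Ĉ₆
        ≡⟨ cong (λ p → p ℚ.- Eₖ G k Ĉ₃ ℚ.- two ℚ.* Eₖ G k Ĉ₅ ℚ.- four ℚ.* Eₖ G k Ĉ₆) (Eₖ-const G W>0 k N) ⟩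
      N ℚ.- Eₖ G k Ĉ₃ ℚ.- two ℚ.* Eₖ G k Ĉ₅ ℚ.- four ℚ.* Eₖ G k Ĉ₆ ∎
      where
      open ≡-Reasoning
      N two four : ℚ
      N = ℕtoℚ (N₁ G)
      two = ℕtoℚ 2
      four = ℕtoℚ 4

    N₁≡ℚ : ℕtoℚ (N₁ G) ≡ C₁ ℚ.+ C₃ ℚ.+ ℕtoℚ 2 ℚ.* C₅ ℚ.+ ℕtoℚ 4 ℚ.* C₆
    N₁≡ℚ = begin
      ℕtoℚ (N₁ G)
        ≡⟨ cong ℕtoℚ (N₁≡ G) ⟩
      ℕtoℚ (C G star3 + C G tailedTriangle + 2 * C G chordalCycle4 + 4 * C G clique4)
        ≡⟨ ℕtoℚ-+ (C G star3 + C G tailedTriangle + 2 * C G chordalCycle4) (4 * C G clique4) ⟩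
      ℕtoℚ (C G star3 + C G tailedTriangle + 2 * C G chordalCycle4) ℚ.+ ℕtoℚ (4 * C G clique4)
        ≡⟨ cong₂ ℚ._+_ (ℕtoℚ-+ (C G star3 + C G tailedTriangle) (2 * C G chordalCycle4))
                       (ℕtoℚ-* 4 (C G clique4)) ⟩
      ℕtoℚ (C G star3 + C G tailedTriangle) ℚ.+ ℕtoℚ (2 * C G chordalCycle4) ℚ.+ ℕtoℚ 4 ℚ.* C₆
        ≡⟨ cong₂ (λ p q → p ℚ.+ q ℚ.+ ℕtoℚ 4 ℚ.* C₆) (ℕtoℚ-+ (C G star3) (C G tailedTriangle))
                                                    (ℕtoℚ-* 2 (C G chordalCycle4)) ⟩
      C₁ ℚ.+ C₃ ℚ.+ ℕtoℚ 2 ℚ.* C₅ ℚ.+ ℕtoℚ 4 ℚ.* C₆ ∎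
      where open ≡-Reasoning

    Ĉ₁-unbiased : Eₖ G k (Ĉ G star3) ≡ C₁
    Ĉ₁-unbiased = begin
      Eₖ G k (Ĉ G star3)
        ≡⟨ Ĉ₁-expectation ⟩
      ℕtoℚ (N₁ G) ℚ.- Eₖ G k Ĉ₃ ℚ.- two ℚ.* Eₖ G k Ĉ₅ ℚ.- four ℚ.* Eₖ G k Ĉ₆
        ≡⟨ cong₂ (λ p q → ℕtoℚ (N₁ G) ℚ.- p ℚ.- two ℚ.* q ℚ.- four ℚ.* Eₖ G k Ĉ₆)
                 (Ĉ'-unbiased tailedTriangle (s≤s z≤n)) (Ĉ'-unbiased chordalCycle4 (s≤s z≤n)) ⟩
      ℕtoℚ (N₁ G) ℚ.- C₃ ℚ.- two ℚ.* C₅ ℚ.- four ℚ.* Eₖ G k Ĉ₆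
        ≡⟨ cong₂ (λ p q → p ℚ.- C₃ ℚ.- two ℚ.* C₅ ℚ.- four ℚ.* q) N₁≡ℚ (Ĉ'-unbiased clique4 (s≤s z≤n)) ⟩
      C₁ ℚ.+ C₃ ℚ.+ two ℚ.* C₅ ℚ.+ four ℚ.* C₆ ℚ.- C₃ ℚ.- two ℚ.* C₅ ℚ.- four ℚ.* C₆
        ≡⟨ solve 6 (λ c₁ c₃ c₅ c₆ t f → c₁ :+ c₃ :+ t :* c₅ :+ f :* c₆ :- c₃ :- t :* c₅ :- f :* c₆ := c₁)
                   refl C₁ C₃ C₅ C₆ two four ⟩
      C₁ ∎
      where
      open ≡-Reasoning
      two four : ℚ
      two = ℕtoℚ 2
      four = ℕtoℚ 4

open Unbiasedness

theorem1 : ∀ {n : ℕ} (G : Graph n) → 0 < W G → (k : ℕ) → k ≥ 1 →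
           (i : Motif) → Eₖ G k (Ĉ G i) ≡ ℕtoℚ (C G i)
theorem1 G W>0 k k≥1 star3          = Ĉ₁-unbiased G W>0 k k≥1
theorem1 G W>0 k k≥1 path3          = Ĉ'-unbiased G W>0 k k≥1 path3 (s≤s z≤n)
theorem1 G W>0 k k≥1 tailedTriangle = Ĉ'-unbiased G W>0 k k≥1 tailedTriangle (s≤s z≤n)
theorem1 G W>0 k k≥1 cycle4         = Ĉ'-unbiased G W>0 k k≥1 cycle4 (s≤s z≤n)
theorem1 G W>0 k k≥1 chordalCycle4  = Ĉ'-unbiased G W>0 k k≥1 chordalCycle4 (s≤s z≤n)
theorem1 G W>0 k k≥1 clique4        = Ĉ'-unbiased G W>0 k k≥1 clique4 (s≤s z≤n)
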